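{- For every positive integer $n$, the statistic $\sigma\mapsto\mathrm{maj}(\sigma)-\mathrm{inv}(\sigma)$ on $S_n$ is $0$-mesic with respect to each of the following bijections $S_n\to S_n$: the Lehmer-code-to-major-code bijection $\mathcal{M}$, its inverse $\mathcal{M}^{ -1}$, the Foata bijection $\mathcal{F}$, and its inverse $\mathcal{F}^{ -1}$.
   Context: A statistic $f$ is $c$-mesic with respect to a bijection $\mathcal{X}$ of a finite set if its average over every orbit of $\mathcal{X}$ equals $c$. For $\sigma\in S_n$ in one-line notation, $\mathrm{inv}(\sigma)=\#\{i<j:\sigma_i>\sigma_j\}$ and $\mathrm{maj}(\sigma)=\sum_{i:\sigma_i>\sigma_{i+1}} i$. Lehmer code: $L(\sigma)_i=\#\{j>i:\sigma_j<\sigma_i\}$, $1\le i\le n$. Major code: for $1\le i\le n+1$ let $\mathrm{del}_i(\sigma)$ be the permutation obtained from $\sigma$ by deleting all entries smaller than $i$ and standardizing (so $\mathrm{del}_1(\sigma)=\sigma$ and $\mathrm{del}_{n+1}(\sigma)$ is empty with major index $0$); $M(\sigma)_i=\mathrm{maj}(\mathrm{del}_i(\sigma))-\mathrm{maj}(\mathrm{del}_{i+1}(\sigma))$. (E.g. $31542$ has major code $(3,3,1,1,0)$.) The map $\sigma\mapsto M(\sigma)$ is a bijection onto the same set of sequences as the Lehmer codes; $\mathcal{M}(\sigma)$ is the unique permutation $\tau$ with $M(\tau)=L(\sigma)$. Foata bijection $\mathcal{F}$: define $\mathcal{F}(\sigma_1)=\sigma_1$. If $\mathcal{F}(\sigma_1\cdots\sigma_i)=\tau_1\cdots\tau_i$,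 obtain $\mathcal{F}(\sigma_1\cdots\sigma_{i+1})$ as follows: place a vertical line to the left of $\tau_1$; if $\sigma_{i+1}>\tau_i$, place a vertical line to the right of each $\tau_k$ with $\sigma_{i+1}>\tau_k$; if $\sigma_{i+1}<\tau_i$, place a vertical line to the right of each $\tau_k$ with $\sigma_{i+1}<\tau_k$; within each block between vertical lines cyclically shift the entries one place to the right, and then append $\sigma_{i+1}$ at the end. $\mathcal{F}(\sigma)=\mathcal{F}(\sigma_1\cdots\sigma_n)$. (E.g. $\mathcal{F}(31542)=53412$.) -}

module Defs where

open import Data.Bool using (Bool; true; false; if_then_else_)
open import Data.Nat using (ℕ; zero; suc; _+_; _∸_; _<_; _≤_; _<ᵇ_; _≤ᵇ_)
import Data.Nat as ℕ
open import Data.Integer using (ℤ; +_; _-_; _*_)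
import Data.Integer as ℤ
open import Data.List using (List; []; _∷_; _++_; [_]; map; filter; length; upTo; concatMap; foldl; reverse)
open import Data.List.Properties using (≡-dec)
open import Data.List.Relation.Binary.Permutation.Propositional using (_↭_)
open import Data.Maybe using (Maybe; just; nothing; fromMaybe)
open import Relation.Nullary.Decidable using (⌊_⌋; Dec)
open import Relation.Binary.PropositionalEquality using (_≡_; _≢_; refl)

-- Permutations in one-line notation are lists of natural numbers.
-- S n : the list σ is a permutation of [1..n].
oneTo : ℕ → List ℕ
oneTo n = map suc (upTo n)

IsPerm : ℕ → List ℕ → Set
IsPerm n σ = σ ↭ oneTo n

countLess : ℕ → List ℕ → ℕ
countLess x xs = length (filter (λ y → y ℕ.<? x) xs)

inv : List ℕ → ℕ
inv [] = 0
inv (x ∷ xs) = countLess x xs + inv xs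

majFrom : ℕ → List ℕ → ℕ
majFrom i (x ∷ y ∷ xs) = (if y <ᵇ x then i else 0) + majFrom (suc i) (y ∷ xs)
majFrom i _ = 0

maj : List ℕ → ℕ
maj = majFrom 1

lehmer : List ℕ → List ℕ
lehmer [] = []
lehmer (x ∷ xs) = countLess x xs ∷ lehmer xs

std : List ℕ → List ℕ
std σ = map (λ x → suc (countLess x σ)) σ

del : ℕ → List ℕ → List ℕ
del i σ = std (filter (λ x → i ℕ.≤? x) σ)

majorCode : List ℕ → List ℕ
majorCode σ = map (λ i → maj (del i σ) ∸ maj (del (suc i) σ)) (oneTo (length σ))

insertAll : ℕ → List ℕ → List (List ℕ)
insertAll x [] = [ x ∷ [] ]
insertAll x (y ∷ ys) = (x ∷ y ∷ ys) ∷ map (y ∷_) (insertAll x ys)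

perms : ℕ → List (List ℕ)
perms zero = [ [] ]
perms (suc n) = concatMap (insertAll (suc n)) (perms n)

_≟L_ : (xs ys : List ℕ) → Dec (xs ≡ ys)
_≟L_ = ≡-dec ℕ._≟_

findFirst : (List ℕ → Bool) → List (List ℕ) → Maybe (List ℕ)
findFirst p [] = nothing
findFirst p (τ ∷ τs) = if p τ then just τ else findFirst p τs

-- the unique τ ∈ S_n (n = length σ) satisfying P τ; (default σ, never used on S_n)
theUnique : (List ℕ → Bool) → List ℕ → List ℕ
theUnique p σ = fromMaybe σ (findFirst p (perms (length σ)))

𝓜 : List ℕ → List ℕ
𝓜 σ = theUnique (λ τ → ⌊ majorCode τ ≟L lehmer σ ⌋) σ

inverseOf : (List ℕ → List ℕ) → List ℕ → List ℕ
inverseOf X σ = theUnique (λ τ → ⌊ X τ ≟L σ ⌋) σ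

𝓜⁻¹ : List ℕ → List ℕ
𝓜⁻¹ = inverseOf 𝓜

lastOr : ℕ → List ℕ → ℕ
lastOr d [] = d
lastOr d (x ∷ xs) = lastOr x xs

-- split into blocks, each block ending at a marked entry (vertical line to its right)
blocks : (ℕ → Bool) → List ℕ → List ℕ → List (List ℕ)
blocks p acc [] = [ acc ]
blocks p acc (y ∷ ys) = if p y then (acc ++ [ y ]) ∷ blocks p [] ys else blocks p (acc ++ [ y ]) ys

rotR : List ℕ → List ℕ
rotR xs with reverse xs
... | [] = []
... | y ∷ ys = y ∷ reverse ys

foataStep : List ℕ → ℕ → List ℕ
foataStep τ x = concatMap rotR (blocks mark [] τ) ++ [ x ]
  where
  mark : ℕ → Bool
  mark t = if lastOr 0 τ <ᵇ x then t <ᵇ x else x <ᵇ t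

𝓕 : List ℕ → List ℕ
𝓕 σ = foldl foataStep [] σ

𝓕⁻¹ : List ℕ → List ℕ
𝓕⁻¹ = inverseOf 𝓕

_ : majorCode (3 ∷ 1 ∷ 5 ∷ 4 ∷ 2 ∷ []) ≡ 3 ∷ 3 ∷ 1 ∷ 1 ∷ 0 ∷ []
_ = refl

_ : 𝓕 (3 ∷ 1 ∷ 5 ∷ 4 ∷ 2 ∷ []) ≡ 5 ∷ 3 ∷ 4 ∷ 1 ∷ 2 ∷ []
_ = refl

iter : (List ℕ → List ℕ) → ℕ → List ℕ → List ℕ
iter X zero σ = σ
iter X (suc k) σ = X (iter X k σ)

orbitSum : (List ℕ → ℤ) → (List ℕ → List ℕ) → ℕ → List ℕ → ℤ
orbitSum f X zero σ = + 0
orbitSum f X (suc p) σ = f σ ℤ.+ orbitSum f X p (X σ)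

Mesic : ℕ → (List ℕ → List ℕ) → (List ℕ → ℤ) → ℤ → Set
Mesic n X f c =
  ∀ σ → IsPerm n σ → ∀ p → 0 < p → iter X p σ ≡ σ →
  (∀ q → 0 < q → q < p → iter X q σ ≢ σ) →
  orbitSum f X p σ ≡ c * + p

majMinusInv : List ℕ → ℤ
majMinusInv σ = + maj σ - + inv σ

-- maj − inv is 0-mesic for a bijection X of S_n as soon as maj σ = inv (X σ) for all σ, or
-- inv σ = maj (X σ) for all σ: it is then the coboundary g ∘ X − g of g = inv, resp. g = −maj, whose
-- sum over an orbit telescopes to 0. The first identity holds for 𝓕 (Foata's theorem: appending x to σ
-- raises maj by |σ| exactly when x is below the last entry, and the matching Foata step rotates blocks so
-- that inv rises by the same amount) and for 𝓜⁻¹; the second holds for 𝓜, since the Lehmer code sums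
-- to inv and the major code sums to maj, and for 𝓕⁻¹. The major code is a bijection onto codes because
-- deleting the minimum entry changes only the first code entry, while inserting a new minimum into the
-- |w| + 1 gaps of a word w raises maj by 0, 1, …, |w| in some order.

module Submission where

open import Defs
open import Data.Bool using (Bool; true; false; if_then_else_; T)
open import Data.Bool.Properties using (T-≡)
open import Data.Empty using (⊥-elim)
open import Data.Integer as ℤ using (ℤ; +_; -_; _-_)
import Data.Integer.Properties as ℤ
open import Data.List
  using (List; []; _∷_; _++_; [_]; _∷ʳ_; map; filter; length; upTo; applyUpTo; concatMap; reverse; take; drop)
open import Data.List.Properties
  using ( map-++; map-upTo; upTo-∷ʳ; length-map; length-upTo; length-filter; length-++; length-++-≤ˡ; length-take
        ; ++-assoc; ++-identityʳ; ∷-injective; reverse-involutive; reverse-++; foldl-∷ʳ; take++drop≡id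
        ; filter-++; filter-all; filter-none; filter-reject )
open import Data.List.Membership.Propositional using (_∈_; _∉_; find; lose)
open import Data.List.Membership.Propositional.Properties
  using (∈-map⁺; ∈-map⁻; ∈-++⁺ʳ; ∈-∃++; ∈-concatMap⁺; ∈-concatMap⁻)
open import Data.List.Relation.Binary.Permutation.Propositional
  using (_↭_; prep; swap; ↭-refl; ↭-sym; ↭-trans; ↭-reflexive; ↭⇒↭ₛ; module PermutationReasoning)
open import Data.List.Relation.Binary.Permutation.Propositional.Properties
  using (∈-resp-↭; All-resp-↭; ↭-empty-inv; ↭-length; ∷↭∷ʳ; drop-mid; shift; ++⁺ˡ; ++⁺ʳ; filter-↭; map⁺)
import Data.List.Relation.Binary.Permutation.Setoid.Properties as ↭ₛ
open import Data.List.Relation.Unary.All using (All; []; _∷_)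
import Data.List.Relation.Unary.All as All
open import Data.List.Relation.Unary.All.Properties using () renaming (++⁺ to All-++⁺; ++⁻ to All-++⁻)
open import Data.List.Relation.Unary.Any using (here; there)
open import Data.List.Relation.Unary.Unique.Propositional using (Unique; _∷_)
import Data.List.Relation.Unary.Unique.Propositional.Properties as Unique
open import Data.List.Reverse using (Reverse; []; _∶_∶ʳ_; reverseView)
open import Data.Maybe using (just)
open import Data.Nat using (ℕ; zero; suc; _+_; _*_; _∸_; _<_; _≤_; _<ᵇ_; _<?_; _≤?_; z≤n; s≤s)
open import Data.Nat.ListAction using (sum)
open import Data.Nat.ListAction.Properties using (sum-++; sum-↭)
open import Data.Nat.Properties
open import Data.Nat.Solver using (module +-*-Solver)
open import Data.Product using (_×_; _,_; proj₁; proj₂; ∃-syntax)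
open import Data.Sum using (_⊎_; inj₁; inj₂)
open import Function.Base using (_∘_)
open import Function.Bundles using (Equivalence)
open import Relation.Binary.Definitions using (tri<; tri≈; tri>)
open import Relation.Binary.PropositionalEquality as ≡ hiding ([_])
open import Relation.Nullary using (yes; no)
open import Relation.Nullary.Decidable using (⌊_⌋; toWitness; fromWitness)

open +-*-Solver

<⇒<ᵇ≡true : ∀ {m n} → m < n → (m <ᵇ n) ≡ true
<⇒<ᵇ≡true m<n = Equivalence.to T-≡ (<⇒<ᵇ m<n)

≤⇒<ᵇ≡false : ∀ {m n} → n ≤ m → (m <ᵇ n) ≡ false
≤⇒<ᵇ≡false z≤n = refl
≤⇒<ᵇ≡false (s≤s n≤m) = ≤⇒<ᵇ≡false n≤m

<ᵇ≡true⇒< : ∀ m n → (m <ᵇ n) ≡ true → m < n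
<ᵇ≡true⇒< m n e = <ᵇ⇒< m n (Equivalence.from T-≡ e)

<ᵇ≡false⇒≤ : ∀ m n → (m <ᵇ n) ≡ false → n ≤ m
<ᵇ≡false⇒≤ m n e = ≮⇒≥ (λ m<n → subst T e (<⇒<ᵇ m<n))

-- Permutations of [1, n] and their enumeration

range : ℕ → ℕ → List ℕ
range lo zero = []
range lo (suc k) = lo ∷ range (suc lo) k

applyUpTo-range : ∀ k lo (f : ℕ → ℕ) → (∀ i → f i ≡ lo + i) → applyUpTo f k ≡ range lo k
applyUpTo-range zero lo f f≗lo+ = refl
applyUpTo-range (suc k) lo f f≗lo+ =
  cong₂ _∷_ (trans (f≗lo+ 0) (+-identityʳ lo))
    (applyUpTo-range k (suc lo) (λ i → f (suc i)) (λ i → trans (f≗lo+ (suc i)) (+-suc lo i)))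

oneTo≡range : ∀ n → oneTo n ≡ range 1 n
oneTo≡range n = trans (map-upTo suc n) (applyUpTo-range n 1 suc (λ _ → refl))

oneTo-suc : ∀ n → oneTo (suc n) ≡ oneTo n ∷ʳ suc n
oneTo-suc n = trans (cong (map suc) (sym (upTo-∷ʳ n))) (map-++ suc (upTo n) [ n ])

length-oneTo : ∀ n → length (oneTo n) ≡ n
length-oneTo n = trans (length-map suc (upTo n)) (length-upTo n)

IsPerm⇒↭range : ∀ {n σ} → IsPerm n σ → σ ↭ range 1 n
IsPerm⇒↭range {n} σ-perm = ↭-trans σ-perm (↭-reflexive (oneTo≡range n))

↭range⇒IsPerm : ∀ {n σ} → σ ↭ range 1 n → IsPerm n σ
↭range⇒IsPerm {n} σ↭ = ↭-trans σ↭ (↭-reflexive (sym (oneTo≡range n)))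

length-IsPerm : ∀ {n σ} → IsPerm n σ → length σ ≡ n
length-IsPerm {n} σ-perm = trans (↭-length σ-perm) (length-oneTo n)

Unique-resp-↭ : ∀ {xs ys : List ℕ} → xs ↭ ys → Unique xs → Unique ys
Unique-resp-↭ xs↭ys = ↭ₛ.Unique-resp-↭ (≡.setoid ℕ) (↭⇒↭ₛ xs↭ys)

Unique-∷ʳ⁻ : ∀ xs x → Unique (xs ∷ʳ x) → x ∉ xs × Unique xs
Unique-∷ʳ⁻ xs x u with Unique-resp-↭ (↭-sym (∷↭∷ʳ x xs)) u
... | u′@(_ ∷ u-xs) = Unique.Unique[x∷xs]⇒x∉xs u′ , u-xs

IsPerm⇒Unique : ∀ {n σ} → IsPerm n σ → Unique σ
IsPerm⇒Unique {n} σ-perm = Unique-resp-↭ (↭-sym σ-perm) (Unique.map⁺ suc-injective (Unique.upTo⁺ n))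

∈-insertAll⁻ : ∀ {zs} x ys → zs ∈ insertAll x ys → zs ↭ x ∷ ys
∈-insertAll⁻ x [] (here refl) = ↭-refl
∈-insertAll⁻ x (y ∷ ys) (here refl) = ↭-refl
∈-insertAll⁻ x (y ∷ ys) (there zs∈) with ∈-map⁻ (y ∷_) zs∈
... | ws , ws∈ , refl = ↭-trans (prep y (∈-insertAll⁻ x ys ws∈)) (swap y x ↭-refl)

∈-insertAll⁺ : ∀ x u v → u ++ x ∷ v ∈ insertAll x (u ++ v)
∈-insertAll⁺ x [] [] = here refl
∈-insertAll⁺ x [] (y ∷ v) = here refl
∈-insertAll⁺ x (y ∷ u) v = there (∈-map⁺ (y ∷_) (∈-insertAll⁺ x u v))

∈-perms⁻ : ∀ n {τ} → τ ∈ perms n → IsPerm n τ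
∈-perms⁻ zero (here refl) = ↭-refl
∈-perms⁻ (suc n) τ∈ with find (∈-concatMap⁻ (insertAll (suc n)) {xs = perms n} τ∈)
... | ρ , ρ∈ , τ∈ρ+ = begin
  _                    ↭⟨ ∈-insertAll⁻ (suc n) ρ τ∈ρ+ ⟩
  suc n ∷ ρ            ↭⟨ prep (suc n) (∈-perms⁻ n ρ∈) ⟩
  suc n ∷ oneTo n      ↭⟨ ∷↭∷ʳ (suc n) (oneTo n) ⟩
  oneTo n ∷ʳ suc n     ≡⟨ oneTo-suc n ⟨
  oneTo (suc n)        ∎
  where open PermutationReasoning

suc∈oneTo-suc : ∀ n → suc n ∈ oneTo (suc n)
suc∈oneTo-suc n = subst (suc n ∈_) (sym (oneTo-suc n)) (∈-++⁺ʳ (oneTo n) (here refl))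

∈-perms⁺ : ∀ n {τ} → IsPerm n τ → τ ∈ perms n
∈-perms⁺ zero τ-perm rewrite ↭-empty-inv τ-perm = here refl
∈-perms⁺ (suc n) τ-perm with ∈-∃++ (∈-resp-↭ (↭-sym τ-perm) (suc∈oneTo-suc n))
... | u , v , refl = ∈-concatMap⁺ (insertAll (suc n)) (lose (∈-perms⁺ n u++v-perm) (∈-insertAll⁺ (suc n) u v))
  where
  u++v-perm : u ++ v ↭ oneTo n
  u++v-perm = ↭-trans (drop-mid u (oneTo n) (↭-trans τ-perm (↭-reflexive (oneTo-suc n))))
                      (↭-reflexive (++-identityʳ (oneTo n)))

≟L-true : ∀ {xs ys} → xs ≡ ys → ⌊ xs ≟L ys ⌋ ≡ true
≟L-true xs≡ys = Equivalence.to T-≡ (fromWitness xs≡ys)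

≟L-true⁻ : ∀ {xs ys} → ⌊ xs ≟L ys ⌋ ≡ true → xs ≡ ys
≟L-true⁻ e = toWitness (Equivalence.from T-≡ e)

findFirst-complete : ∀ (p : List ℕ → Bool) τs {τ} → τ ∈ τs → p τ ≡ true →
  ∃[ ρ ] (findFirst p τs ≡ just ρ × ρ ∈ τs × p ρ ≡ true)
findFirst-complete p (ρ ∷ τs) (here refl) pρ rewrite pρ = ρ , refl , here refl , pρ
findFirst-complete p (ρ ∷ τs) (there τ∈) pτ with p ρ in pρ
... | true = ρ , refl , here refl , pρ
... | false with findFirst-complete p τs τ∈ pτ
...   | ρ′ , found , ρ′∈ , pρ′ = ρ′ , found , there ρ′∈ , pρ′

theUnique-finds : ∀ (F : List ℕ → List ℕ) c {n σ} → IsPerm n σ → (∃[ τ ] (IsPerm n τ × F τ ≡ c)) →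
  let ρ = theUnique (λ τ → ⌊ F τ ≟L c ⌋) σ in IsPerm n ρ × F ρ ≡ c
theUnique-finds F c {n} {σ} σ-perm (τ , τ-perm , Fτ≡c) with length-IsPerm σ-perm
... | refl with findFirst-complete (λ τ → ⌊ F τ ≟L c ⌋) (perms n) (∈-perms⁺ n τ-perm) (≟L-true Fτ≡c)
...   | ρ , found , ρ∈ , Fρ≡c rewrite found = ∈-perms⁻ n ρ∈ , ≟L-true⁻ Fρ≡c

-- Coboundaries are 0-mesic

iter-X : ∀ X p (σ : List ℕ) → iter X p (X σ) ≡ X (iter X p σ)
iter-X X zero σ = refl
iter-X X (suc p) σ = cong X (iter-X X p σ)

orbitSum-coboundary : ∀ {P : List ℕ → Set} X (f g : List ℕ → ℤ) →
  (∀ {σ} → P σ → P (X σ)) → (∀ {σ} → P σ → f σ ≡ g (X σ) - g σ) →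
  ∀ p {σ} → P σ → orbitSum f X p σ ≡ g (iter X p σ) - g σ
orbitSum-coboundary X f g _ _ zero {σ} _ = sym (ℤ.+-inverseʳ (g σ))
orbitSum-coboundary X f g pres f≡δg (suc p) {σ} Pσ = begin
  f σ ℤ.+ orbitSum f X p (X σ)
    ≡⟨ cong₂ ℤ._+_ (f≡δg Pσ) (orbitSum-coboundary X f g pres f≡δg p (pres Pσ)) ⟩
  (g (X σ) - g σ) ℤ.+ (g (iter X p (X σ)) - g (X σ))
    ≡⟨ ℤ.+-comm (g (X σ) - g σ) _ ⟩
  (g (iter X p (X σ)) - g (X σ)) ℤ.+ (g (X σ) - g σ)
    ≡⟨ ℤ.+-minus-telescope (g (iter X p (X σ))) (g (X σ)) (g σ) ⟩
  g (iter X p (X σ)) - g σ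
    ≡⟨ cong (λ ρ → g ρ - g σ) (iter-X X p σ) ⟩
  g (X (iter X p σ)) - g σ
    ∎
  where open ≡-Reasoning

coboundary⇒mesic : ∀ n X (f g : List ℕ → ℤ) →
  (∀ {σ} → IsPerm n σ → IsPerm n (X σ)) → (∀ {σ} → IsPerm n σ → f σ ≡ g (X σ) - g σ) →
  Mesic n X f (+ 0)
coboundary⇒mesic n X f g pres f≡δg σ σ-perm p _ Xᵖσ≡σ _ = begin
  orbitSum f X p σ       ≡⟨ orbitSum-coboundary X f g pres f≡δg p σ-perm ⟩
  g (iter X p σ) - g σ   ≡⟨ cong (λ ρ → g ρ - g σ) Xᵖσ≡σ ⟩
  g σ - g σ              ≡⟨ ℤ.+-inverseʳ (g σ) ⟩
  + 0                    ∎
  where open ≡-Reasoning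

maj≡inv∘X⇒mesic : ∀ n X → (∀ {σ} → IsPerm n σ → IsPerm n (X σ)) →
  (∀ {σ} → IsPerm n σ → maj σ ≡ inv (X σ)) → Mesic n X majMinusInv (+ 0)
maj≡inv∘X⇒mesic n X pres maj≡inv∘X =
  coboundary⇒mesic n X majMinusInv (λ σ → + inv σ) pres
    (λ {σ} σ-perm → cong (λ m → + m - + inv σ) (maj≡inv∘X σ-perm))

inv≡maj∘X⇒mesic : ∀ n X → (∀ {σ} → IsPerm n σ → IsPerm n (X σ)) →
  (∀ {σ} → IsPerm n σ → inv σ ≡ maj (X σ)) → Mesic n X majMinusInv (+ 0)
inv≡maj∘X⇒mesic n X pres inv≡maj∘X =
  coboundary⇒mesic n X majMinusInv (λ σ → - + maj σ) pres δ
  where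
  δ : ∀ {σ} → IsPerm n σ → + maj σ - + inv σ ≡ - + maj (X σ) - - + maj σ
  δ {σ} σ-perm = begin
    + maj σ - + inv σ             ≡⟨ cong (λ m → + maj σ - + m) (inv≡maj∘X σ-perm) ⟩
    + maj σ - + maj (X σ)         ≡⟨ ℤ.+-comm (+ maj σ) (- + maj (X σ)) ⟩
    - + maj (X σ) ℤ.+ + maj σ     ≡⟨ cong (ℤ._+_ (- + maj (X σ))) (ℤ.neg-involutive (+ maj σ)) ⟨
    - + maj (X σ) - - + maj σ     ∎
    where open ≡-Reasoning

-- Inversions

countLess-∷ : ∀ x y ys → countLess x (y ∷ ys) ≡ (if y <ᵇ x then suc (countLess x ys) else countLess x ys)
countLess-∷ x y ys with y <ᵇ x
... | true = refl
... | false = refl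

countLess-∷-≥ : ∀ {x y} ys → x ≤ y → countLess x (y ∷ ys) ≡ countLess x ys
countLess-∷-≥ {x} {y} ys x≤y =
  trans (countLess-∷ x y ys) (cong (if_then suc (countLess x ys) else countLess x ys) (≤⇒<ᵇ≡false x≤y))

countLess-++ : ∀ a xs ys → countLess a (xs ++ ys) ≡ countLess a xs + countLess a ys
countLess-++ a xs ys = trans (cong length (filter-++ (_<? a) xs ys)) (length-++ (filter (_<? a) xs))

countLess-↭ : ∀ a {xs ys} → xs ↭ ys → countLess a xs ≡ countLess a ys
countLess-↭ a xs↭ys = ↭-length (filter-↭ (_<? a) xs↭ys)

countLess-all< : ∀ a {xs} → All (_< a) xs → countLess a xs ≡ length xs
countLess-all< a xs<a = cong length (filter-all (_<? a) xs<a)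

countLess-all≥ : ∀ a {xs} → All (a ≤_) xs → countLess a xs ≡ 0
countLess-all≥ a a≤xs = cong length (filter-none (_<? a) (All.map ≤⇒≯ a≤xs))

crossInv : List ℕ → List ℕ → ℕ
crossInv xs ys = sum (map (λ a → countLess a ys) xs)

crossInv-++ˡ : ∀ xs ys zs → crossInv (xs ++ ys) zs ≡ crossInv xs zs + crossInv ys zs
crossInv-++ˡ xs ys zs rewrite map-++ (λ a → countLess a zs) xs ys = sum-++ (map _ xs) _

crossInv-++ʳ : ∀ xs ys zs → crossInv xs (ys ++ zs) ≡ crossInv xs ys + crossInv xs zs
crossInv-++ʳ [] ys zs = refl
crossInv-++ʳ (x ∷ xs) ys zs rewrite countLess-++ x ys zs | crossInv-++ʳ xs ys zs =
  solve 4 (λ a b c d → (a :+ b) :+ (c :+ d) := (a :+ c) :+ (b :+ d)) refl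
    (countLess x ys) (countLess x zs) (crossInv xs ys) (crossInv xs zs)

crossInv-↭ˡ : ∀ {xs ys} zs → xs ↭ ys → crossInv xs zs ≡ crossInv ys zs
crossInv-↭ˡ zs xs↭ys = sum-↭ (map⁺ (λ a → countLess a zs) xs↭ys)

crossInv-↭ʳ : ∀ xs {ys zs} → ys ↭ zs → crossInv xs ys ≡ crossInv xs zs
crossInv-↭ʳ [] _ = refl
crossInv-↭ʳ (x ∷ xs) ys↭zs = cong₂ _+_ (countLess-↭ x ys↭zs) (crossInv-↭ʳ xs ys↭zs)

crossInv-[]-all> : ∀ y {xs} → All (y <_) xs → crossInv xs [ y ] ≡ length xs
crossInv-[]-all> y [] = refl
crossInv-[]-all> y {x ∷ _} (y<x ∷ y<xs) rewrite <⇒<ᵇ≡true y<x = cong suc (crossInv-[]-all> y y<xs)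

crossInv-[]-all< : ∀ y {xs} → All (_< y) xs → crossInv xs [ y ] ≡ 0
crossInv-[]-all< y [] = refl
crossInv-[]-all< y {x ∷ _} (x<y ∷ xs<y) rewrite ≤⇒<ᵇ≡false (<⇒≤ x<y) = crossInv-[]-all< y xs<y

countLess+crossInv-[] : ∀ x τ → x ∉ τ → countLess x τ + crossInv τ [ x ] ≡ length τ
countLess+crossInv-[] x [] _ = refl
countLess+crossInv-[] x (z ∷ τ) x∉ rewrite countLess-∷ x z τ with <-cmp z x
... | tri< z<x _ _ rewrite <⇒<ᵇ≡true z<x | ≤⇒<ᵇ≡false (<⇒≤ z<x) =
  cong suc (countLess+crossInv-[] x τ (x∉ ∘ there))
... | tri≈ _ refl _ = ⊥-elim (x∉ (here refl))
... | tri> _ _ x<z rewrite ≤⇒<ᵇ≡false (<⇒≤ x<z) | <⇒<ᵇ≡true x<z =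
  trans (+-suc _ _) (cong suc (countLess+crossInv-[] x τ (x∉ ∘ there)))

inv-++ : ∀ xs ys → inv (xs ++ ys) ≡ inv xs + inv ys + crossInv xs ys
inv-++ [] ys = sym (+-identityʳ (inv ys))
inv-++ (x ∷ xs) ys rewrite countLess-++ x xs ys | inv-++ xs ys =
  solve 5 (λ a b c d e → a :+ b :+ (c :+ d :+ e) := a :+ c :+ d :+ (b :+ e)) refl
    (countLess x xs) (countLess x ys) (inv xs) (inv ys) (crossInv xs ys)

inv-∷ʳ : ∀ xs x → inv (xs ∷ʳ x) ≡ inv xs + crossInv xs [ x ]
inv-∷ʳ xs x = trans (inv-++ xs [ x ]) (cong (_+ crossInv xs [ x ]) (+-identityʳ (inv xs)))

-- The Foata bijection

lastOr-∈ : ∀ y ys → lastOr y ys ∈ y ∷ ys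
lastOr-∈ y [] = here refl
lastOr-∈ y (z ∷ zs) = there (lastOr-∈ z zs)

lastOr-∷ʳ : ∀ d zs x → lastOr d (zs ∷ʳ x) ≡ x
lastOr-∷ʳ d [] x = refl
lastOr-∷ʳ d (z ∷ zs) x = lastOr-∷ʳ z zs x

lastOr-++ : ∀ d xs ys → lastOr d (xs ++ ys) ≡ lastOr (lastOr d xs) ys
lastOr-++ d [] ys = refl
lastOr-++ d (x ∷ xs) ys = lastOr-++ x xs ys

rotR-∷ʳ : ∀ xs y → rotR (xs ∷ʳ y) ≡ y ∷ xs
rotR-∷ʳ xs y with reverse (xs ++ [ y ]) | reverse-++ xs [ y ]
... | _ | refl = cong (y ∷_) (reverse-involutive xs)

rotR-↭ : ∀ xs → rotR xs ↭ xs
rotR-↭ xs with reverseView xs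
... | [] = ↭-refl
... | ys ∶ _ ∶ʳ y = ↭-trans (↭-reflexive (rotR-∷ʳ ys y)) (∷↭∷ʳ y ys)

rotateBlocks : (ℕ → Bool) → List ℕ → List ℕ → List ℕ
rotateBlocks p acc τ = concatMap rotR (blocks p acc τ)

foataMark : List ℕ → ℕ → ℕ → Bool
foataMark τ x t = if lastOr 0 τ <ᵇ x then t <ᵇ x else x <ᵇ t

blocks-cong : ∀ {p q} → (∀ z → p z ≡ q z) → ∀ acc τ → blocks p acc τ ≡ blocks q acc τ
blocks-cong p≗q acc [] = refl
blocks-cong {q = q} p≗q acc (y ∷ ys) rewrite p≗q y with q y
... | true = cong (_ ∷_) (blocks-cong p≗q [] ys)
... | false = blocks-cong p≗q (acc ++ [ y ]) ys

rotateBlocks-↭ : ∀ p acc τ → rotateBlocks p acc τ ↭ acc ++ τ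
rotateBlocks-↭ p acc [] =
  ↭-trans (↭-reflexive (++-identityʳ (rotR acc))) (↭-trans (rotR-↭ acc) (↭-reflexive (sym (++-identityʳ acc))))
rotateBlocks-↭ p acc (y ∷ ys) with p y
... | true rewrite rotR-∷ʳ acc y =
  ↭-trans (prep y (++⁺ˡ acc (rotateBlocks-↭ p [] ys))) (↭-sym (shift y acc ys))
... | false = ↭-trans (rotateBlocks-↭ p (acc ++ [ y ]) ys) (↭-reflexive (++-assoc acc [ y ] ys))

foataStep-↭ : ∀ τ x → foataStep τ x ↭ τ ∷ʳ x
foataStep-↭ τ x = ++⁺ʳ [ x ] (rotateBlocks-↭ (foataMark τ x) [] τ)

foataStep-below : ∀ τ x → lastOr 0 τ < x → foataStep τ x ≡ rotateBlocks (_<ᵇ x) [] τ ∷ʳ x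
foataStep-below τ x l<x = cong (λ bs → concatMap rotR bs ++ [ x ])
  (blocks-cong (λ t → cong (if_then t <ᵇ x else x <ᵇ t) (<⇒<ᵇ≡true l<x)) [] τ)

foataStep-above : ∀ τ x → x < lastOr 0 τ → foataStep τ x ≡ rotateBlocks (x <ᵇ_) [] τ ∷ʳ x
foataStep-above τ x x<l = cong (λ bs → concatMap rotR bs ++ [ x ])
  (blocks-cong (λ t → cong (if_then t <ᵇ x else x <ᵇ t) (≤⇒<ᵇ≡false (<⇒≤ x<l))) [] τ)

-- The last block produced by blocks p acc τ is empty.
LastBlockClosed : (ℕ → Bool) → List ℕ → List ℕ → Set
LastBlockClosed p acc [] = acc ≡ []
LastBlockClosed p acc (y ∷ ys) = if p y then LastBlockClosed p [] ys else LastBlockClosed p (acc ++ [ y ]) ys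

lastMarked⇒LastBlockClosed : ∀ p acc y ys → p (lastOr y ys) ≡ true → LastBlockClosed p acc (y ∷ ys)
lastMarked⇒LastBlockClosed p acc y [] py rewrite py = refl
lastMarked⇒LastBlockClosed p acc y (z ∷ zs) pl with p y
... | true = lastMarked⇒LastBlockClosed p [] z zs pl
... | false = lastMarked⇒LastBlockClosed p (acc ++ [ y ]) z zs pl

inv-rotatedBlock : ∀ y acc G ys → G ↭ ys →
  inv ((y ∷ acc) ++ G) ≡ countLess y acc + inv acc + inv G + (countLess y ys + crossInv acc ys)
inv-rotatedBlock y acc G ys G↭ys =
  trans (inv-++ (y ∷ acc) G) (cong (_+_ (inv (y ∷ acc) + inv G)) (crossInv-↭ʳ (y ∷ acc) G↭ys))

inv-++-∷ : ∀ acc y ys →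
  inv (acc ++ y ∷ ys) ≡ inv acc + (countLess y ys + inv ys) + (crossInv acc [ y ] + crossInv acc ys)
inv-++-∷ acc y ys =
  trans (inv-++ acc (y ∷ ys)) (cong (_+_ (inv acc + inv (y ∷ ys))) (crossInv-++ʳ acc [ y ] ys))

-- Rotating a block moves its last entry y < x in front of the others, which all exceed x:
-- every entry above x loses exactly one inversion.
inv-rotateBlocks-< : ∀ x acc τ → x ∉ τ → All (x <_) acc → LastBlockClosed (_<ᵇ x) acc τ →
  inv (rotateBlocks (_<ᵇ x) acc τ) + crossInv (acc ++ τ) [ x ] ≡ inv (acc ++ τ)
inv-rotateBlocks-< x acc [] _ _ refl = refl
inv-rotateBlocks-< x acc (y ∷ ys) x∉ x<acc closed with y <ᵇ x in y<ᵇx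
... | true = begin
    inv (rotR (acc ∷ʳ y) ++ G) + crossInv (acc ++ y ∷ ys) [ x ]
      ≡⟨ cong (λ b → inv (b ++ G) + crossInv (acc ++ y ∷ ys) [ x ]) (rotR-∷ʳ acc y) ⟩
    inv ((y ∷ acc) ++ G) + crossInv (acc ++ y ∷ ys) [ x ]
      ≡⟨ cong₂ _+_ (inv-rotatedBlock y acc G ys (rotateBlocks-↭ _ [] ys)) crossInv-x ⟩
    countLess y acc + inv acc + inv G + (countLess y ys + crossInv acc ys) + (length acc + crossInv ys [ x ])
      ≡⟨ cong (λ c → c + inv acc + inv G + (countLess y ys + crossInv acc ys) + (length acc + crossInv ys [ x ]))
              (countLess-all≥ y (All.map <⇒≤ y<acc)) ⟩
    inv acc + inv G + (countLess y ys + crossInv acc ys) + (length acc + crossInv ys [ x ])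
      ≡⟨ solve 6 (λ a g c d l e → a :+ g :+ (c :+ d) :+ (l :+ e) := a :+ (c :+ (g :+ e)) :+ (l :+ d)) refl
                 (inv acc) (inv G) (countLess y ys) (crossInv acc ys) (length acc) (crossInv ys [ x ]) ⟩
    inv acc + (countLess y ys + (inv G + crossInv ys [ x ])) + (length acc + crossInv acc ys)
      ≡⟨ cong₂ (λ i l → inv acc + (countLess y ys + i) + (l + crossInv acc ys))
               (inv-rotateBlocks-< x [] ys (x∉ ∘ there) [] closed) (sym (crossInv-[]-all> y y<acc)) ⟩
    inv acc + (countLess y ys + inv ys) + (crossInv acc [ y ] + crossInv acc ys)
      ≡⟨ inv-++-∷ acc y ys ⟨
    inv (acc ++ y ∷ ys) ∎
  where
  open ≡-Reasoning
  G : List ℕ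
  G = rotateBlocks (_<ᵇ x) [] ys
  y<x : y < x
  y<x = <ᵇ≡true⇒< y x y<ᵇx
  y<acc : All (y <_) acc
  y<acc = All.map (<-trans y<x) x<acc
  crossInv-x : crossInv (acc ++ y ∷ ys) [ x ] ≡ length acc + crossInv ys [ x ]
  crossInv-x = trans (crossInv-++ˡ acc (y ∷ ys) [ x ])
    (cong₂ _+_ (crossInv-[]-all> x x<acc) (cong (_+ crossInv ys [ x ]) (countLess-∷-≥ [] (<⇒≤ y<x))))
... | false =
  subst (λ l → inv (rotateBlocks (_<ᵇ x) (acc ∷ʳ y) ys) + crossInv l [ x ] ≡ inv l) (++-assoc acc [ y ] ys)
    (inv-rotateBlocks-< x (acc ∷ʳ y) ys (x∉ ∘ there) (All-++⁺ x<acc (x<y ∷ [])) closed)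
  where
  x<y : x < y
  x<y = ≤∧≢⇒< (<ᵇ≡false⇒≤ y x y<ᵇx) (x∉ ∘ here)

-- Here the last entry y > x moves in front of entries that are all below x: every entry below x
-- gains exactly one inversion.
inv-rotateBlocks-> : ∀ x acc τ → x ∉ τ → All (_< x) acc → LastBlockClosed (x <ᵇ_) acc τ →
  inv (rotateBlocks (x <ᵇ_) acc τ) ≡ inv (acc ++ τ) + countLess x (acc ++ τ)
inv-rotateBlocks-> x acc [] _ _ refl = refl
inv-rotateBlocks-> x acc (y ∷ ys) x∉ acc<x closed with x <ᵇ y in x<ᵇy
... | true = begin
    inv (rotR (acc ∷ʳ y) ++ G)
      ≡⟨ cong (λ b → inv (b ++ G)) (rotR-∷ʳ acc y) ⟩
    inv ((y ∷ acc) ++ G)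
      ≡⟨ inv-rotatedBlock y acc G ys (rotateBlocks-↭ _ [] ys) ⟩
    countLess y acc + inv acc + inv G + (countLess y ys + crossInv acc ys)
      ≡⟨ cong₂ (λ c g → c + inv acc + g + (countLess y ys + crossInv acc ys))
               (countLess-all< y acc<y) (inv-rotateBlocks-> x [] ys (x∉ ∘ there) [] closed) ⟩
    length acc + inv acc + (inv ys + countLess x ys) + (countLess y ys + crossInv acc ys)
      ≡⟨ solve 6 (λ l a i c d e → l :+ a :+ (i :+ c) :+ (d :+ e) := a :+ (d :+ i) :+ (con 0 :+ e) :+ (l :+ c)) refl
                 (length acc) (inv acc) (inv ys) (countLess x ys) (countLess y ys) (crossInv acc ys) ⟩
    inv acc + (countLess y ys + inv ys) + (0 + crossInv acc ys) + (length acc + countLess x ys)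
      ≡⟨ cong₂ (λ c d → inv acc + (countLess y ys + inv ys) + (c + crossInv acc ys) + d)
               (sym (crossInv-[]-all< y acc<y)) (sym countLess-x) ⟩
    inv acc + (countLess y ys + inv ys) + (crossInv acc [ y ] + crossInv acc ys) + countLess x (acc ++ y ∷ ys)
      ≡⟨ cong (_+ countLess x (acc ++ y ∷ ys)) (inv-++-∷ acc y ys) ⟨
    inv (acc ++ y ∷ ys) + countLess x (acc ++ y ∷ ys) ∎
  where
  open ≡-Reasoning
  G : List ℕ
  G = rotateBlocks (x <ᵇ_) [] ys
  x<y : x < y
  x<y = <ᵇ≡true⇒< x y x<ᵇy
  acc<y : All (_< y) acc
  acc<y = All.map (λ z<x → <-trans z<x x<y) acc<x
  countLess-x : countLess x (acc ++ y ∷ ys) ≡ length acc + countLess x ys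
  countLess-x =
    trans (countLess-++ x acc (y ∷ ys)) (cong₂ _+_ (countLess-all< x acc<x) (countLess-∷-≥ ys (<⇒≤ x<y)))
... | false =
  subst (λ l → inv (rotateBlocks (x <ᵇ_) (acc ∷ʳ y) ys) ≡ inv l + countLess x l) (++-assoc acc [ y ] ys)
    (inv-rotateBlocks-> x (acc ∷ʳ y) ys (x∉ ∘ there) (All-++⁺ acc<x (y<x ∷ [])) closed)
  where
  y<x : y < x
  y<x = ≤∧≢⇒< (<ᵇ≡false⇒≤ x y x<ᵇy) (x∉ ∘ here ∘ sym)

inv-foataStep : ∀ τ x → x ∉ τ → inv (foataStep τ x) ≡ inv τ + (if x <ᵇ lastOr 0 τ then length τ else 0)
inv-foataStep [] x _ = refl
inv-foataStep τ@(y ∷ ys) x x∉ with <-cmp (lastOr y ys) x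
... | tri< l<x _ _ rewrite foataStep-below τ x l<x | ≤⇒<ᵇ≡false (<⇒≤ l<x) = begin
    inv (G ∷ʳ x)              ≡⟨ inv-∷ʳ G x ⟩
    inv G + crossInv G [ x ]  ≡⟨ cong (_+_ (inv G)) (crossInv-↭ˡ [ x ] (rotateBlocks-↭ (_<ᵇ x) [] τ)) ⟩
    inv G + crossInv τ [ x ]  ≡⟨ inv-rotateBlocks-< x [] τ x∉ [] closed ⟩
    inv τ                     ≡⟨ +-identityʳ (inv τ) ⟨
    inv τ + 0                 ∎
  where
  open ≡-Reasoning
  G : List ℕ
  G = rotateBlocks (_<ᵇ x) [] τ
  closed : LastBlockClosed (_<ᵇ x) [] τ
  closed = lastMarked⇒LastBlockClosed _ [] y ys (<⇒<ᵇ≡true l<x)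
... | tri≈ _ l≡x _ = ⊥-elim (x∉ (subst (_∈ τ) l≡x (lastOr-∈ y ys)))
... | tri> _ _ x<l rewrite foataStep-above τ x x<l | <⇒<ᵇ≡true x<l = begin
    inv (G ∷ʳ x)                                  ≡⟨ inv-∷ʳ G x ⟩
    inv G + crossInv G [ x ]                      ≡⟨ cong₂ _+_ (inv-rotateBlocks-> x [] τ x∉ [] closed)
                                                               (crossInv-↭ˡ [ x ] (rotateBlocks-↭ (x <ᵇ_) [] τ)) ⟩
    inv τ + countLess x τ + crossInv τ [ x ]      ≡⟨ +-assoc (inv τ) _ _ ⟩
    inv τ + (countLess x τ + crossInv τ [ x ])    ≡⟨ cong (_+_ (inv τ)) (countLess+crossInv-[] x τ x∉) ⟩
    inv τ + length τ                              ∎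
  where
  open ≡-Reasoning
  G : List ℕ
  G = rotateBlocks (x <ᵇ_) [] τ
  closed : LastBlockClosed (x <ᵇ_) [] τ
  closed = lastMarked⇒LastBlockClosed _ [] y ys (<⇒<ᵇ≡true x<l)

majFrom-∷ʳ : ∀ i y ys x →
  majFrom i ((y ∷ ys) ∷ʳ x) ≡ majFrom i (y ∷ ys) + (if x <ᵇ lastOr y ys then i + length ys else 0)
majFrom-∷ʳ i y [] x with x <ᵇ y
... | true = refl
... | false = refl
majFrom-∷ʳ i y (z ∷ zs) x rewrite majFrom-∷ʳ (suc i) z zs x with x <ᵇ lastOr z zs
... | true = solve 4 (λ a m i l → a :+ (m :+ (con 1 :+ i :+ l)) := a :+ m :+ (i :+ (con 1 :+ l))) refl
               (if z <ᵇ y then i else 0) (majFrom (suc i) (z ∷ zs)) i (length zs)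
... | false = sym (+-assoc (if z <ᵇ y then i else 0) _ 0)

maj-∷ʳ : ∀ xs x → maj (xs ∷ʳ x) ≡ maj xs + (if x <ᵇ lastOr 0 xs then length xs else 0)
maj-∷ʳ [] x = refl
maj-∷ʳ (y ∷ ys) x = majFrom-∷ʳ 1 y ys x

𝓕-∷ʳ : ∀ xs x → 𝓕 (xs ∷ʳ x) ≡ foataStep (𝓕 xs) x
𝓕-∷ʳ xs x = foldl-∷ʳ foataStep [] x xs

𝓕-↭ : ∀ σ → 𝓕 σ ↭ σ
𝓕-↭ σ = go (reverseView σ)
  where
  go : ∀ {σ} → Reverse σ → 𝓕 σ ↭ σ
  go [] = ↭-refl
  go (xs ∶ rs ∶ʳ x) rewrite 𝓕-∷ʳ xs x = ↭-trans (foataStep-↭ (𝓕 xs) x) (++⁺ʳ [ x ] (go rs))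

lastOr-𝓕 : ∀ σ → lastOr 0 (𝓕 σ) ≡ lastOr 0 σ
lastOr-𝓕 σ with reverseView σ
... | [] = refl
... | xs ∶ _ ∶ʳ x rewrite 𝓕-∷ʳ xs x = trans (lastOr-∷ʳ 0 (rotateBlocks _ [] (𝓕 xs)) x) (sym (lastOr-∷ʳ 0 xs x))

maj≡inv∘𝓕 : ∀ {σ} → Unique σ → maj σ ≡ inv (𝓕 σ)
maj≡inv∘𝓕 {σ} = go (reverseView σ)
  where
  go : ∀ {σ} → Reverse σ → Unique σ → maj σ ≡ inv (𝓕 σ)
  go [] _ = refl
  go (xs ∶ rs ∶ʳ x) u with Unique-∷ʳ⁻ xs x u
  ... | x∉xs , u-xs = begin
    maj (xs ∷ʳ x)
      ≡⟨ maj-∷ʳ xs x ⟩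
    maj xs + (if x <ᵇ lastOr 0 xs then length xs else 0)
      ≡⟨ cong₂ (λ m l → m + (if x <ᵇ l then length xs else 0)) (go rs u-xs) (sym (lastOr-𝓕 xs)) ⟩
    inv (𝓕 xs) + (if x <ᵇ lastOr 0 (𝓕 xs) then length xs else 0)
      ≡⟨ cong (λ k → inv (𝓕 xs) + (if x <ᵇ lastOr 0 (𝓕 xs) then k else 0)) (sym (↭-length (𝓕-↭ xs))) ⟩
    inv (𝓕 xs) + (if x <ᵇ lastOr 0 (𝓕 xs) then length (𝓕 xs) else 0)
      ≡⟨ inv-foataStep (𝓕 xs) x (x∉xs ∘ ∈-resp-↭ (𝓕-↭ xs)) ⟨
    inv (foataStep (𝓕 xs) x)
      ≡⟨ cong inv (𝓕-∷ʳ xs x) ⟨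
    inv (𝓕 (xs ∷ʳ x))
      ∎
    where open ≡-Reasoning

-- Inverse to rotateBlocks p on h ∷ acc ++ ρ, where h is marked and acc unmarked: each marked entry
-- opens a new block, which is closed by moving its first entry to its end.
unrotateBlocks : (ℕ → Bool) → ℕ → List ℕ → List ℕ → List ℕ
unrotateBlocks p h acc [] = acc ∷ʳ h
unrotateBlocks p h acc (y ∷ ys) =
  if p y then (acc ∷ʳ h) ++ unrotateBlocks p y [] ys else unrotateBlocks p h (acc ∷ʳ y) ys

blocks-++-marked : ∀ p A B h R → All (λ z → p z ≡ false) B → p h ≡ true →
  blocks p A (B ++ h ∷ R) ≡ ((A ++ B) ∷ʳ h) ∷ blocks p [] R
blocks-++-marked p A [] h R [] ph rewrite ph | ++-identityʳ A = refl
blocks-++-marked p A (b ∷ B) h R (pb ∷ pB) ph rewrite pb =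
  trans (blocks-++-marked p (A ∷ʳ b) B h R pB ph) (cong (λ C → (C ∷ʳ h) ∷ blocks p [] R) (++-assoc A [ b ] B))

rotateBlocks-unrotateBlocks : ∀ p h acc ys → p h ≡ true → All (λ z → p z ≡ false) acc →
  rotateBlocks p [] (unrotateBlocks p h acc ys) ≡ h ∷ acc ++ ys
rotateBlocks-unrotateBlocks p h acc [] ph acc-unmarked = begin
  concatMap rotR (blocks p [] (acc ++ h ∷ []))
    ≡⟨ cong (concatMap rotR) (blocks-++-marked p [] acc h [] acc-unmarked ph) ⟩
  rotR (acc ∷ʳ h) ++ []
    ≡⟨ cong (_++ []) (rotR-∷ʳ acc h) ⟩
  h ∷ acc ++ []
    ∎
  where open ≡-Reasoning
rotateBlocks-unrotateBlocks p h acc (y ∷ ys) ph acc-unmarked with p y in py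
... | true = begin
  rotateBlocks p [] ((acc ∷ʳ h) ++ U)
    ≡⟨ cong (rotateBlocks p []) (++-assoc acc [ h ] U) ⟩
  concatMap rotR (blocks p [] (acc ++ h ∷ U))
    ≡⟨ cong (concatMap rotR) (blocks-++-marked p [] acc h U acc-unmarked ph) ⟩
  rotR (acc ∷ʳ h) ++ rotateBlocks p [] U
    ≡⟨ cong₂ _++_ (rotR-∷ʳ acc h) (rotateBlocks-unrotateBlocks p y [] ys py []) ⟩
  h ∷ acc ++ y ∷ ys
    ∎
  where
  open ≡-Reasoning
  U : List ℕ
  U = unrotateBlocks p y [] ys
... | false = trans (rotateBlocks-unrotateBlocks p h (acc ∷ʳ y) ys ph (All-++⁺ acc-unmarked (py ∷ [])))
                    (cong (h ∷_) (++-assoc acc [ y ] ys))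

unrotateBlocks-↭ : ∀ p h acc ys → unrotateBlocks p h acc ys ↭ h ∷ acc ++ ys
unrotateBlocks-↭ p h acc [] = shift h acc []
unrotateBlocks-↭ p h acc (y ∷ ys) with p y
... | true = ↭-trans (↭-reflexive (++-assoc acc [ h ] _))
               (↭-trans (++⁺ˡ acc (prep h (unrotateBlocks-↭ p y [] ys))) (shift h acc (y ∷ ys)))
... | false = ↭-trans (unrotateBlocks-↭ p h (acc ∷ʳ y) ys) (↭-reflexive (cong (h ∷_) (++-assoc acc [ y ] ys)))

unrotateBlocks-lastMarked : ∀ (p : ℕ → Bool) h acc ys (d : ℕ) → p h ≡ true →
  p (lastOr d (unrotateBlocks p h acc ys)) ≡ true
unrotateBlocks-lastMarked p h acc [] d ph rewrite lastOr-∷ʳ d acc h = ph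
unrotateBlocks-lastMarked p h acc (y ∷ ys) d ph with p y in py
... | true rewrite lastOr-++ d (acc ∷ʳ h) (unrotateBlocks p y [] ys) = unrotateBlocks-lastMarked p y [] ys _ py
... | false = unrotateBlocks-lastMarked p h (acc ∷ʳ y) ys d ph

foataStep-surjectiveFor : ∀ q r rs x → q r ≡ true →
  (∀ τ → q (lastOr 0 τ) ≡ true → foataStep τ x ≡ rotateBlocks q [] τ ∷ʳ x) →
  ∃[ τ ] (τ ↭ r ∷ rs × foataStep τ x ≡ (r ∷ rs) ∷ʳ x)
foataStep-surjectiveFor q r rs x qr step =
  τ , unrotateBlocks-↭ q r [] rs ,
  trans (step τ (unrotateBlocks-lastMarked q r [] rs 0 qr)) (cong (_∷ʳ x) (rotateBlocks-unrotateBlocks q r [] rs qr []))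
  where
  τ : List ℕ
  τ = unrotateBlocks q r [] rs

foataStep-surjective : ∀ ρ x → x ∉ ρ → ∃[ τ ] (τ ↭ ρ × foataStep τ x ≡ ρ ∷ʳ x)
foataStep-surjective [] x _ = [] , ↭-refl , refl
foataStep-surjective (r ∷ rs) x x∉ with <-cmp r x
... | tri< r<x _ _ = foataStep-surjectiveFor (_<ᵇ x) r rs x (<⇒<ᵇ≡true r<x)
                       (λ τ l<ᵇx → foataStep-below τ x (<ᵇ≡true⇒< _ x l<ᵇx))
... | tri≈ _ r≡x _ = ⊥-elim (x∉ (here (sym r≡x)))
... | tri> _ _ x<r = foataStep-surjectiveFor (x <ᵇ_) r rs x (<⇒<ᵇ≡true x<r)
                       (λ τ x<ᵇl → foataStep-above τ x (<ᵇ≡true⇒< x _ x<ᵇl))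

length-∷ʳ : ∀ (xs : List ℕ) x → length (xs ∷ʳ x) ≡ suc (length xs)
length-∷ʳ [] x = refl
length-∷ʳ (_ ∷ xs) x = cong suc (length-∷ʳ xs x)

𝓕-surjective : ∀ {σ} → Unique σ → ∃[ τ ] (τ ↭ σ × 𝓕 τ ≡ σ)
𝓕-surjective {σ} = go (length σ) refl
  where
  go : ∀ n {σ} → length σ ≡ n → Unique σ → ∃[ τ ] (τ ↭ σ × 𝓕 τ ≡ σ)
  go n {σ} len u with reverseView σ
  go n len u | [] = [] , ↭-refl , refl
  go zero len u | ρ ∶ _ ∶ʳ x with () ← trans (sym (length-∷ʳ ρ x)) len
  go (suc n) len u | ρ ∶ _ ∶ʳ x with Unique-∷ʳ⁻ ρ x u
  ... | x∉ρ , u-ρ with foataStep-surjective ρ x x∉ρ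
  ...   | τ′ , τ′↭ρ , step≡ρx
    with go n (trans (↭-length τ′↭ρ) (suc-injective (trans (sym (length-∷ʳ ρ x)) len)))
              (Unique-resp-↭ (↭-sym τ′↭ρ) u-ρ)
  ...     | τ , τ↭τ′ , 𝓕τ≡τ′ =
    τ ∷ʳ x ,
    ++⁺ʳ [ x ] (↭-trans τ↭τ′ τ′↭ρ) ,
    trans (𝓕-∷ʳ τ x) (trans (cong (λ t → foataStep t x) 𝓕τ≡τ′) step≡ρx)

-- Standardisation and insertion of a new minimum

countLess-mono-≤ : ∀ {a b} ys → a ≤ b → countLess a ys ≤ countLess b ys
countLess-mono-≤ [] _ = z≤n
countLess-mono-≤ {a} {b} (y ∷ ys) a≤b rewrite countLess-∷ a y ys | countLess-∷ b y ys
  with y <ᵇ a in y<ᵇa | y <ᵇ b in y<ᵇb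
... | true  | true  = s≤s (countLess-mono-≤ ys a≤b)
... | false | false = countLess-mono-≤ ys a≤b
... | false | true  = m≤n⇒m≤1+n (countLess-mono-≤ ys a≤b)
... | true  | false = ⊥-elim (<⇒≱ (<-≤-trans (<ᵇ≡true⇒< y a y<ᵇa) a≤b) (<ᵇ≡false⇒≤ y b y<ᵇb))

countLess-mono-< : ∀ {a b} ys → b < a → b ∈ ys → countLess b ys < countLess a ys
countLess-mono-< {a} {b} (b ∷ ys) b<a (here refl)
  rewrite countLess-∷ a b ys | countLess-∷ b b ys | <⇒<ᵇ≡true b<a | ≤⇒<ᵇ≡false (≤-refl {b}) =
  s≤s (countLess-mono-≤ ys (<⇒≤ b<a))
countLess-mono-< {a} {b} (y ∷ ys) b<a (there b∈) rewrite countLess-∷ a y ys | countLess-∷ b y ys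
  with y <ᵇ b in y<ᵇb | y <ᵇ a in y<ᵇa
... | true  | true  = s≤s (countLess-mono-< ys b<a b∈)
... | false | false = countLess-mono-< ys b<a b∈
... | false | true  = m≤n⇒m≤1+n (countLess-mono-< ys b<a b∈)
... | true  | false = ⊥-elim (<⇒≱ (<-trans (<ᵇ≡true⇒< y b y<ᵇb) b<a) (<ᵇ≡false⇒≤ y a y<ᵇa))

majFrom-map : ∀ i (g : ℕ → ℕ) zs → (∀ {a b} → a ∈ zs → b ∈ zs → (g b <ᵇ g a) ≡ (b <ᵇ a)) →
  majFrom i (map g zs) ≡ majFrom i zs
majFrom-map i g [] _ = refl
majFrom-map i g (x ∷ []) _ = refl
majFrom-map i g (x ∷ y ∷ ys) g-monotone =
  cong₂ _+_ (cong (if_then i else 0) (g-monotone (here refl) (there (here refl))))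
    (majFrom-map (suc i) g (y ∷ ys) (λ a∈ b∈ → g-monotone (there a∈) (there b∈)))

maj-std : ∀ ys → maj (std ys) ≡ maj ys
maj-std ys = majFrom-map 1 (λ x → suc (countLess x ys)) ys rank-monotone
  where
  rank-monotone : ∀ {a b} → a ∈ ys → b ∈ ys → (countLess b ys <ᵇ countLess a ys) ≡ (b <ᵇ a)
  rank-monotone {a} {b} _ b∈ with <-cmp b a
  ... | tri< b<a _ _ = trans (<⇒<ᵇ≡true (countLess-mono-< ys b<a b∈)) (sym (<⇒<ᵇ≡true b<a))
  ... | tri≈ _ refl _ = trans (≤⇒<ᵇ≡false (≤-refl {countLess b ys})) (sym (≤⇒<ᵇ≡false (≤-refl {b})))
  ... | tri> _ _ a<b = trans (≤⇒<ᵇ≡false (countLess-mono-≤ ys (<⇒≤ a<b))) (sym (≤⇒<ᵇ≡false (<⇒≤ a<b)))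

descents : List ℕ → ℕ
descents (x ∷ y ∷ ys) = (if y <ᵇ x then 1 else 0) + descents (y ∷ ys)
descents _ = 0

-- Gap j of w (0 ≤ j ≤ length w) lies just after the j-th entry; ascentGap w j is 1 when the
-- gap j ≥ 1 is an ascent or the last gap, and 0 otherwise.
ascentGap : List ℕ → ℕ → ℕ
ascentGap [] j = 0
ascentGap (x ∷ xs) zero = 0
ascentGap (x ∷ []) (suc j) = 1
ascentGap (x ∷ y ∷ ys) (suc zero) = if y <ᵇ x then 0 else 1
ascentGap (x ∷ y ∷ ys) (suc (suc j)) = ascentGap (y ∷ ys) (suc j)

-- The increase of maj when an entry smaller than all entries of w is inserted into gap j.
majGain : List ℕ → ℕ → ℕ
majGain w zero = descents w
majGain [] (suc j) = 0
majGain (x ∷ []) (suc j) = 1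
majGain (x ∷ y ∷ ys) (suc zero) = (if y <ᵇ x then 0 else 1) + descents (y ∷ ys)
majGain (x ∷ y ∷ ys) (suc (suc j)) = majGain (y ∷ ys) (suc j) + ascentGap (y ∷ ys) (suc j)

majFrom-suc : ∀ i w → majFrom (suc i) w ≡ majFrom i w + descents w
majFrom-suc i [] = refl
majFrom-suc i (x ∷ []) = refl
majFrom-suc i (x ∷ y ∷ ys) rewrite majFrom-suc (suc i) (y ∷ ys) with y <ᵇ x
... | true = solve 3 (λ i a d → con 1 :+ i :+ (a :+ d) := i :+ a :+ (con 1 :+ d)) refl
               i (majFrom (suc i) (y ∷ ys)) (descents (y ∷ ys))
... | false = refl

-- In majFrom (suc i) positions are offset by i, so the descent that the new minimum creates
-- in an ascent gap counts i more.
majFrom-insertMin : ∀ i u m v → All (m <_) (u ++ v) →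
  majFrom (suc i) (u ++ m ∷ v) ≡
  majFrom (suc i) (u ++ v) + (majGain (u ++ v) (length u) + i * ascentGap (u ++ v) (length u))
majFrom-insertMin i [] m [] _ = cong (_+_ 0) (sym (*-zeroʳ i))
majFrom-insertMin i [] m (y ∷ ys) (m<y ∷ _)
  rewrite ≤⇒<ᵇ≡false (<⇒≤ m<y) | majFrom-suc (suc i) (y ∷ ys) | *-zeroʳ i =
  cong (_+_ (majFrom (suc i) (y ∷ ys))) (sym (+-identityʳ (descents (y ∷ ys))))
majFrom-insertMin i (x ∷ []) m [] (m<x ∷ _) rewrite <⇒<ᵇ≡true m<x | *-identityʳ i = +-identityʳ (suc i)
majFrom-insertMin i (x ∷ []) m (y ∷ ys) (m<x ∷ m<y ∷ _)
  rewrite <⇒<ᵇ≡true m<x | ≤⇒<ᵇ≡false (<⇒≤ m<y) | majFrom-suc (suc (suc i)) (y ∷ ys) with y <ᵇ x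
... | true rewrite *-zeroʳ i =
  solve 3 (λ i m d → con 1 :+ i :+ (m :+ d) := con 1 :+ i :+ m :+ (d :+ con 0)) refl
    i (majFrom (suc (suc i)) (y ∷ ys)) (descents (y ∷ ys))
... | false rewrite *-identityʳ i =
  solve 3 (λ i m d → con 1 :+ i :+ (m :+ d) := m :+ (con 1 :+ d :+ i)) refl
    i (majFrom (suc (suc i)) (y ∷ ys)) (descents (y ∷ ys))
majFrom-insertMin i (x ∷ x′ ∷ u) m v (_ ∷ m<u) rewrite majFrom-insertMin (suc i) (x′ ∷ u) m v m<u =
  solve 5 (λ a b c d e → a :+ (b :+ (c :+ (con 1 :+ e) :* d)) := a :+ b :+ (c :+ d :+ e :* d)) refl
    (if x′ <ᵇ x then suc i else 0) (majFrom (suc (suc i)) (x′ ∷ u ++ v))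
    (majGain (x′ ∷ u ++ v) (suc (length u))) (ascentGap (x′ ∷ u ++ v) (suc (length u))) i

maj-insertMin : ∀ u m v → All (m <_) (u ++ v) →
  maj (u ++ m ∷ v) ≡ maj (u ++ v) + majGain (u ++ v) (length u)
maj-insertMin u m v m<uv = trans (majFrom-insertMin 0 u m v m<uv) (cong (_+_ (maj (u ++ v))) (+-identityʳ _))

descents-≤ : ∀ w → descents w ≤ length w
descents-≤ [] = z≤n
descents-≤ (x ∷ []) = z≤n
descents-≤ (x ∷ y ∷ ys) with y <ᵇ x | descents-≤ (y ∷ ys)
... | true  | r≤ = s≤s r≤
... | false | r≤ = m≤n⇒m≤1+n r≤

descents-∷-bounds : ∀ x y ys →
  descents (y ∷ ys) ≤ descents (x ∷ y ∷ ys) × descents (x ∷ y ∷ ys) ≤ suc (descents (y ∷ ys))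
descents-∷-bounds x y ys with y <ᵇ x
... | true = n≤1+n _ , ≤-refl
... | false = ≤-refl , n≤1+n _

ascentGap-≤1 : ∀ w j → ascentGap w j ≤ 1
ascentGap-≤1 [] j = z≤n
ascentGap-≤1 (x ∷ xs) zero = z≤n
ascentGap-≤1 (x ∷ []) (suc j) = ≤-refl
ascentGap-≤1 (x ∷ y ∷ ys) (suc zero) with y <ᵇ x
... | true = z≤n
... | false = ≤-refl
ascentGap-≤1 (x ∷ y ∷ ys) (suc (suc j)) = ascentGap-≤1 (y ∷ ys) (suc j)

-- With r = descents (y ∷ ys), the gaps 0 and 1 of x ∷ y ∷ ys gain r and r + 1 in some order,
-- while every later gap gains less than r or more than r + 1 (majGain-avoids).
majGain-0-1 : ∀ x y ys → let r = descents (y ∷ ys) in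
  (majGain (x ∷ y ∷ ys) 0 ≡ suc r × majGain (x ∷ y ∷ ys) 1 ≡ r) ⊎
  (majGain (x ∷ y ∷ ys) 0 ≡ r × majGain (x ∷ y ∷ ys) 1 ≡ suc r)
majGain-0-1 x y ys with y <ᵇ x
... | true = inj₁ (refl , refl)
... | false = inj₂ (refl , refl)

majGain-≤ : ∀ w {j} → j ≤ length w → majGain w j ≤ length w
majGain-≤ w {zero} _ = descents-≤ w
majGain-≤ (x ∷ []) {suc j} _ = ≤-refl
majGain-≤ (x ∷ y ∷ ys) {suc zero} _ with majGain-0-1 x y ys
... | inj₁ (_ , g₁) rewrite g₁ = m≤n⇒m≤1+n (descents-≤ (y ∷ ys))
... | inj₂ (_ , g₁) rewrite g₁ = s≤s (descents-≤ (y ∷ ys))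
majGain-≤ (x ∷ y ∷ ys) {suc (suc j)} (s≤s j<) =
  subst (_≤ suc (length (y ∷ ys))) (+-comm (ascentGap (y ∷ ys) (suc j)) _)
    (+-mono-≤ (ascentGap-≤1 (y ∷ ys) (suc j)) (majGain-≤ (y ∷ ys) j<))

majGain-vs-descents : ∀ w j → 1 ≤ j → j ≤ length w →
  (ascentGap w j ≡ 1 × descents w < majGain w j) ⊎ (ascentGap w j ≡ 0 × majGain w j < descents w)
majGain-vs-descents (x ∷ []) (suc zero) _ _ = inj₁ (refl , s≤s z≤n)
majGain-vs-descents (x ∷ []) (suc (suc j)) _ (s≤s ())
majGain-vs-descents (x ∷ y ∷ ys) (suc zero) _ _ with y <ᵇ x
... | true = inj₂ (refl , ≤-refl)
... | false = inj₁ (refl , ≤-refl)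
majGain-vs-descents (x ∷ y ∷ ys) (suc (suc j)) _ (s≤s j<)
  with descents-∷-bounds x y ys | majGain-vs-descents (y ∷ ys) (suc j) (s≤s z≤n) j<
... | _ , d≤r+1 | inj₁ (a≡1 , r<g) rewrite a≡1 =
  inj₁ (refl , ≤-<-trans d≤r+1 (subst (suc (descents (y ∷ ys)) <_) (+-comm 1 (majGain (y ∷ ys) (suc j))) (s≤s r<g)))
... | r≤d , _ | inj₂ (a≡0 , g<r) rewrite a≡0 | +-identityʳ (majGain (y ∷ ys) (suc j)) =
  inj₂ (refl , <-≤-trans g<r r≤d)

majGain-avoids : ∀ x y ys k → suc k ≤ length (y ∷ ys) → let r = descents (y ∷ ys) in
  suc r < majGain (x ∷ y ∷ ys) (suc (suc k)) ⊎ majGain (x ∷ y ∷ ys) (suc (suc k)) < r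
majGain-avoids x y ys k k< with majGain-vs-descents (y ∷ ys) (suc k) (s≤s z≤n) k<
... | inj₁ (a≡1 , r<g) rewrite a≡1 =
  inj₁ (subst (suc (descents (y ∷ ys)) <_) (+-comm 1 (majGain (y ∷ ys) (suc k))) (s≤s r<g))
... | inj₂ (a≡0 , g<r) rewrite a≡0 = inj₂ (subst (_< _) (sym (+-identityʳ _)) g<r)

majGain-0≢1 : ∀ x y ys → majGain (x ∷ y ∷ ys) 0 ≢ majGain (x ∷ y ∷ ys) 1
majGain-0≢1 x y ys e with majGain-0-1 x y ys
... | inj₁ (g₀ , g₁) = 1+n≢n (trans (sym g₀) (trans e g₁))
... | inj₂ (g₀ , g₁) = 1+n≢n (sym (trans (sym g₀) (trans e g₁)))

majGain-low : ∀ x y ys {j} → j ≤ 1 →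
  majGain (x ∷ y ∷ ys) j ≡ descents (y ∷ ys) ⊎ majGain (x ∷ y ∷ ys) j ≡ suc (descents (y ∷ ys))
majGain-low x y ys {zero} _ with majGain-0-1 x y ys
... | inj₁ (g₀ , _) = inj₂ g₀
... | inj₂ (g₀ , _) = inj₁ g₀
majGain-low x y ys {suc zero} _ with majGain-0-1 x y ys
... | inj₁ (_ , g₁) = inj₁ g₁
... | inj₂ (_ , g₁) = inj₂ g₁
majGain-low x y ys {suc (suc _)} (s≤s ())

majGain-onto-low : ∀ x y ys {c} → c ≡ descents (y ∷ ys) ⊎ c ≡ suc (descents (y ∷ ys)) →
  ∃[ j ] (j ≤ length (x ∷ y ∷ ys) × majGain (x ∷ y ∷ ys) j ≡ c)
majGain-onto-low x y ys c-low with majGain-0-1 x y ys | c-low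
... | inj₁ (_ , g₁) | inj₁ refl = 1 , s≤s z≤n , g₁
... | inj₁ (g₀ , _) | inj₂ refl = 0 , z≤n , g₀
... | inj₂ (g₀ , _) | inj₁ refl = 0 , z≤n , g₀
... | inj₂ (_ , g₁) | inj₂ refl = 1 , s≤s z≤n , g₁

low≢avoiding : ∀ {r u v} → u ≡ r ⊎ u ≡ suc r → suc r < v ⊎ v < r → u ≢ v
low≢avoiding (inj₁ refl) (inj₁ r+1<r) refl = <-asym (n<1+n _) r+1<r
low≢avoiding (inj₁ refl) (inj₂ r<r) refl = <-irrefl refl r<r
low≢avoiding (inj₂ refl) (inj₁ r+1<r+1) refl = <-irrefl refl r+1<r+1
low≢avoiding (inj₂ refl) (inj₂ r+1<r) refl = <-asym (n<1+n _) r+1<r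

raised≢kept : ∀ {r a b} → r < a → b < r → a + 1 ≢ b + 0
raised≢kept {a = a} {b} r<a b<r e =
  <-asym (<-trans b<r r<a) (subst (a <_) (trans (+-comm 1 a) (trans e (+-identityʳ b))) (n<1+n a))

majGain-injective : ∀ w {j k} → j ≤ length w → k ≤ length w → majGain w j ≡ majGain w k → j ≡ k
majGain-injective [] z≤n z≤n _ = refl
majGain-injective (x ∷ []) {0} {0} _ _ _ = refl
majGain-injective (x ∷ []) {1} {1} _ _ _ = refl
majGain-injective (x ∷ []) {0} {1} _ _ ()
majGain-injective (x ∷ []) {1} {0} _ _ ()
majGain-injective (x ∷ []) {suc (suc _)} (s≤s ()) _ _
majGain-injective (x ∷ []) {_} {suc (suc _)} _ (s≤s ()) _
majGain-injective (x ∷ y ∷ ys) {0} {0} _ _ _ = refl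
majGain-injective (x ∷ y ∷ ys) {1} {1} _ _ _ = refl
majGain-injective (x ∷ y ∷ ys) {0} {1} _ _ e = ⊥-elim (majGain-0≢1 x y ys e)
majGain-injective (x ∷ y ∷ ys) {1} {0} _ _ e = ⊥-elim (majGain-0≢1 x y ys (sym e))
majGain-injective (x ∷ y ∷ ys) {0} {suc (suc k)} _ (s≤s k<) e =
  ⊥-elim (low≢avoiding (majGain-low x y ys z≤n) (majGain-avoids x y ys k k<) e)
majGain-injective (x ∷ y ∷ ys) {1} {suc (suc k)} _ (s≤s k<) e =
  ⊥-elim (low≢avoiding (majGain-low x y ys ≤-refl) (majGain-avoids x y ys k k<) e)
majGain-injective (x ∷ y ∷ ys) {suc (suc j)} {0} (s≤s j<) _ e =
  ⊥-elim (low≢avoiding (majGain-low x y ys z≤n) (majGain-avoids x y ys j j<) (sym e))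
majGain-injective (x ∷ y ∷ ys) {suc (suc j)} {1} (s≤s j<) _ e =
  ⊥-elim (low≢avoiding (majGain-low x y ys ≤-refl) (majGain-avoids x y ys j j<) (sym e))
majGain-injective (x ∷ y ∷ ys) {suc (suc j)} {suc (suc k)} (s≤s j<) (s≤s k<) e
  with majGain-vs-descents (y ∷ ys) (suc j) (s≤s z≤n) j< | majGain-vs-descents (y ∷ ys) (suc k) (s≤s z≤n) k<
... | inj₁ (aj , _) | inj₁ (ak , _) rewrite aj | ak = cong suc (majGain-injective (y ∷ ys) j< k< (+-cancelʳ-≡ _ _ _ e))
... | inj₂ (aj , _) | inj₂ (ak , _) rewrite aj | ak = cong suc (majGain-injective (y ∷ ys) j< k< (+-cancelʳ-≡ _ _ _ e))
... | inj₁ (aj , r<gj) | inj₂ (ak , gk<r) rewrite aj | ak = ⊥-elim (raised≢kept r<gj gk<r e)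
... | inj₂ (aj , gj<r) | inj₁ (ak , r<gk) rewrite aj | ak = ⊥-elim (raised≢kept r<gk gj<r (sym e))

MajGainOnto : List ℕ → Set
MajGainOnto w = ∀ {c} → c ≤ length w → ∃[ j ] (j ≤ length w × majGain w j ≡ c)

majGain-onto-∷ : ∀ x y ys → MajGainOnto (y ∷ ys) → MajGainOnto (x ∷ y ∷ ys)
majGain-onto-∷ x y ys onto {c} c≤ with <-cmp c (descents (y ∷ ys))
... | tri≈ _ c≡r _ = majGain-onto-low x y ys (inj₁ c≡r)
... | tri< c<r _ _ with onto (≤-trans (<⇒≤ c<r) (descents-≤ (y ∷ ys)))
...   | zero , _ , r≡c = ⊥-elim (<-irrefl (sym r≡c) c<r)
...   | suc a , a< , g≡c with majGain-vs-descents (y ∷ ys) (suc a) (s≤s z≤n) a<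
...     | inj₁ (_ , r<g) = ⊥-elim (<-asym c<r (subst (descents (y ∷ ys) <_) g≡c r<g))
...     | inj₂ (a≡0 , _) = suc (suc a) , s≤s a< , trans (cong₂ _+_ g≡c a≡0) (+-identityʳ c)
majGain-onto-∷ x y ys onto {c} c≤ | tri> _ _ r<c with c ≟ suc (descents (y ∷ ys))
... | yes c≡r+1 = majGain-onto-low x y ys (inj₂ c≡r+1)
majGain-onto-∷ x y ys onto {suc c} (s≤s c≤) | tri> _ _ r<c | no c≢r+1 with onto c≤
... | zero , _ , r≡c = ⊥-elim (c≢r+1 (cong suc (sym r≡c)))
... | suc a , a< , g≡c with majGain-vs-descents (y ∷ ys) (suc a) (s≤s z≤n) a<
...   | inj₁ (a≡1 , _) = suc (suc a) , s≤s a< , trans (cong₂ _+_ g≡c a≡1) (+-comm c 1)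
...   | inj₂ (_ , g<r) =
  ⊥-elim (<-asym (subst (_< descents (y ∷ ys)) g≡c g<r) (≤∧≢⇒< (≤-pred r<c) (c≢r+1 ∘ cong suc ∘ sym)))

majGain-surjective : ∀ w → MajGainOnto w
majGain-surjective [] z≤n = 0 , z≤n , refl
majGain-surjective (x ∷ []) z≤n = 0 , z≤n , refl
majGain-surjective (x ∷ []) (s≤s z≤n) = 1 , ≤-refl , refl
majGain-surjective (x ∷ y ∷ ys) = majGain-onto-∷ x y ys (majGain-surjective (y ∷ ys))

-- Major codes

atLeast : ℕ → List ℕ → List ℕ
atLeast i σ = filter (i ≤?_) σ

atLeast-all : ∀ i {xs} → All (i ≤_) xs → atLeast i xs ≡ xs
atLeast-all i = filter-all (i ≤?_)

majorCodeAt : List ℕ → ℕ → ℕ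
majorCodeAt σ i = maj (del i σ) ∸ maj (del (suc i) σ)

majorCodeAt≡ : ∀ σ i → majorCodeAt σ i ≡ maj (atLeast i σ) ∸ maj (atLeast (suc i) σ)
majorCodeAt≡ σ i = cong₂ _∸_ (maj-std (atLeast i σ)) (maj-std (atLeast (suc i) σ))

majorCodeFrom : ℕ → List ℕ → ℕ → List ℕ
majorCodeFrom lo σ k = map (majorCodeAt σ) (range lo k)

majorCodeFrom-cong : ∀ k lo σ σ′ → (∀ i → lo ≤ i → majorCodeAt σ i ≡ majorCodeAt σ′ i) →
  majorCodeFrom lo σ k ≡ majorCodeFrom lo σ′ k
majorCodeFrom-cong zero lo σ σ′ _ = refl
majorCodeFrom-cong (suc k) lo σ σ′ agree =
  cong₂ _∷_ (agree lo ≤-refl) (majorCodeFrom-cong k (suc lo) σ σ′ (λ i lo<i → agree i (<⇒≤ lo<i)))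

length-range : ∀ lo k → length (range lo k) ≡ k
length-range lo zero = refl
length-range lo (suc k) = cong suc (length-range (suc lo) k)

length-majorCodeFrom : ∀ lo σ k → length (majorCodeFrom lo σ k) ≡ k
length-majorCodeFrom lo σ k = trans (length-map (majorCodeAt σ) (range lo k)) (length-range lo k)

range-≥ : ∀ lo k → All (lo ≤_) (range lo k)
range-≥ lo zero = []
range-≥ lo (suc k) = ≤-refl ∷ All.map <⇒≤ (range-≥ (suc lo) k)

data IsCode : List ℕ → Set where
  [] : IsCode []
  _∷_ : ∀ {c cs} → c ≤ length cs → IsCode cs → IsCode (c ∷ cs)

-- Inserting the minimum lo of u ++ lo ∷ v changes only the first entry of the major code.
module InsertMinimum (lo : ℕ) (u v : List ℕ) (lo<uv : All (lo <_) (u ++ v)) where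

  σ w : List ℕ
  σ = u ++ lo ∷ v
  w = u ++ v

  atLeast-above : ∀ i → lo < i → atLeast i σ ≡ atLeast i w
  atLeast-above i lo<i = begin
    atLeast i σ                         ≡⟨ filter-++ (i ≤?_) u (lo ∷ v) ⟩
    atLeast i u ++ atLeast i (lo ∷ v)   ≡⟨ cong (atLeast i u ++_) (filter-reject (i ≤?_) (<⇒≱ lo<i)) ⟩
    atLeast i u ++ atLeast i v          ≡⟨ filter-++ (i ≤?_) u v ⟨
    atLeast i w                         ∎
    where open ≡-Reasoning

  atLeast-suc-lo : atLeast (suc lo) σ ≡ w
  atLeast-suc-lo = trans (atLeast-above (suc lo) ≤-refl) (atLeast-all (suc lo) lo<uv)

  atLeast-lo : atLeast lo σ ≡ σ
  atLeast-lo with All-++⁻ u lo<uv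
  ... | lo<u , lo<v = atLeast-all lo (All-++⁺ (All.map <⇒≤ lo<u) (≤-refl ∷ All.map <⇒≤ lo<v))

  majorCodeAt-lo : majorCodeAt σ lo ≡ majGain w (length u)
  majorCodeAt-lo = begin
    majorCodeAt σ lo                               ≡⟨ majorCodeAt≡ σ lo ⟩
    maj (atLeast lo σ) ∸ maj (atLeast (suc lo) σ)  ≡⟨ cong₂ (λ a b → maj a ∸ maj b) atLeast-lo atLeast-suc-lo ⟩
    maj σ ∸ maj w                                  ≡⟨ cong (_∸ maj w) (maj-insertMin u lo v lo<uv) ⟩
    maj w + majGain w (length u) ∸ maj w           ≡⟨ m+n∸m≡n (maj w) _ ⟩
    majGain w (length u)                           ∎
    where open ≡-Reasoning

  majorCodeFrom-above : ∀ k → majorCodeFrom (suc lo) σ k ≡ majorCodeFrom (suc lo) w k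
  majorCodeFrom-above k = majorCodeFrom-cong k (suc lo) σ w λ i lo<i → begin
    majorCodeAt σ i                                 ≡⟨ majorCodeAt≡ σ i ⟩
    maj (atLeast i σ) ∸ maj (atLeast (suc i) σ)     ≡⟨ cong₂ (λ a b → maj a ∸ maj b)
                                                               (atLeast-above i lo<i)
                                                               (atLeast-above (suc i) (m≤n⇒m≤1+n lo<i)) ⟩
    maj (atLeast i w) ∸ maj (atLeast (suc i) w)     ≡⟨ majorCodeAt≡ w i ⟨
    majorCodeAt w i                                 ∎
    where open ≡-Reasoning

removeMinimum : ∀ lo k σ → σ ↭ range lo (suc k) →
  ∃[ u ] ∃[ v ] (σ ≡ u ++ lo ∷ v × u ++ v ↭ range (suc lo) k)
removeMinimum lo k σ σ↭ with ∈-∃++ (∈-resp-↭ (↭-sym σ↭) (here refl))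
... | u , v , refl = u , v , refl , drop-mid u [] σ↭

length-↭range : ∀ {lo k xs} → xs ↭ range lo k → length xs ≡ k
length-↭range {lo} {k} xs↭ = trans (↭-length xs↭) (length-range lo k)

range-above : ∀ {lo k xs} → xs ↭ range (suc lo) k → All (lo <_) xs
range-above {lo} {k} xs↭ = All-resp-↭ (↭-sym xs↭) (range-≥ (suc lo) k)

maj≡sum-majorCodeFrom : ∀ k lo σ → σ ↭ range lo k → maj σ ≡ sum (majorCodeFrom lo σ k)
maj≡sum-majorCodeFrom zero lo τ τ↭ rewrite ↭-empty-inv τ↭ = refl
maj≡sum-majorCodeFrom (suc k) lo τ τ↭ with removeMinimum lo k τ τ↭
... | u , v , refl , w↭ = begin
  maj σ
    ≡⟨ maj-insertMin u lo v (range-above w↭) ⟩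
  maj w + majGain w (length u)
    ≡⟨ +-comm (maj w) _ ⟩
  majGain w (length u) + maj w
    ≡⟨ cong₂ _+_ (sym majorCodeAt-lo) (maj≡sum-majorCodeFrom k (suc lo) w w↭) ⟩
  majorCodeAt σ lo + sum (majorCodeFrom (suc lo) w k)
    ≡⟨ cong (λ c → majorCodeAt σ lo + sum c) (majorCodeFrom-above k) ⟨
  sum (majorCodeFrom lo σ (suc k))
    ∎
  where
  open InsertMinimum lo u v (range-above w↭)
  open ≡-Reasoning

majorCodeFrom-isCode : ∀ k lo σ → σ ↭ range lo k → IsCode (majorCodeFrom lo σ k)
majorCodeFrom-isCode zero lo τ _ = []
majorCodeFrom-isCode (suc k) lo τ τ↭ with removeMinimum lo k τ τ↭
... | u , v , refl , w↭ =
  subst (_≤ length (majorCodeFrom (suc lo) σ k)) (sym majorCodeAt-lo) gain≤ ∷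
  subst IsCode (sym (majorCodeFrom-above k)) (majorCodeFrom-isCode k (suc lo) w w↭)
  where
  open InsertMinimum lo u v (range-above w↭)
  gain≤ : majGain w (length u) ≤ length (majorCodeFrom (suc lo) σ k)
  gain≤ = ≤-trans (majGain-≤ w (length-++-≤ˡ u))
            (≤-reflexive (trans (length-↭range w↭) (sym (length-majorCodeFrom (suc lo) σ k))))

++-injective : ∀ (u u′ : List ℕ) {v v′} → length u ≡ length u′ →
  u ++ v ≡ u′ ++ v′ → u ≡ u′ × v ≡ v′
++-injective [] [] _ e = refl , e
++-injective (x ∷ u) (x′ ∷ u′) len e with ∷-injective e
... | refl , e′ with ++-injective u u′ (suc-injective len) e′
...   | refl , refl = refl , refl

majorCodeFrom-injective : ∀ k lo τ τ′ → τ ↭ range lo k → τ′ ↭ range lo k →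
  majorCodeFrom lo τ k ≡ majorCodeFrom lo τ′ k → τ ≡ τ′
majorCodeFrom-injective zero lo τ τ′ τ↭ τ′↭ _ rewrite ↭-empty-inv τ↭ | ↭-empty-inv τ′↭ = refl
majorCodeFrom-injective (suc k) lo τ τ′ τ↭ τ′↭ e
  with removeMinimum lo k τ τ↭ | removeMinimum lo k τ′ τ′↭
... | u , v , refl , w↭ | u′ , v′ , refl , w′↭ with ∷-injective e
...   | heads≡ , tails≡ = cong₂ (λ a b → a ++ lo ∷ b) (proj₁ u,v≡u′,v′) (proj₂ u,v≡u′,v′)
  where
  module A = InsertMinimum lo u v (range-above w↭)
  module B = InsertMinimum lo u′ v′ (range-above w′↭)
  w≡w′ : u ++ v ≡ u′ ++ v′
  w≡w′ = majorCodeFrom-injective k (suc lo) (u ++ v) (u′ ++ v′) w↭ w′↭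
           (trans (sym (A.majorCodeFrom-above k)) (trans tails≡ (B.majorCodeFrom-above k)))
  gains≡ : majGain (u ++ v) (length u) ≡ majGain (u ++ v) (length u′)
  gains≡ = trans (sym A.majorCodeAt-lo)
             (trans heads≡ (trans B.majorCodeAt-lo (cong (λ w → majGain w (length u′)) (sym w≡w′))))
  same-length : length u ≡ length u′
  same-length = majGain-injective (u ++ v) (length-++-≤ˡ u)
                  (subst (λ w → length u′ ≤ length w) (sym w≡w′) (length-++-≤ˡ u′)) gains≡
  u,v≡u′,v′ : u ≡ u′ × v ≡ v′
  u,v≡u′,v′ = ++-injective u u′ same-length w≡w′

-- Insert lo into the gap of a witness for the tail of c whose gain is the head of c.
majorCodeFrom-surjective : ∀ c lo → IsCode c →
  ∃[ τ ] (τ ↭ range lo (length c) × majorCodeFrom lo τ (length c) ≡ c)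
majorCodeFrom-surjective [] lo [] = [] , ↭-refl , refl
majorCodeFrom-surjective (c ∷ cs) lo (c≤ ∷ cs-code) with majorCodeFrom-surjective cs (suc lo) cs-code
... | ρ , ρ↭ , code≡cs with majGain-surjective ρ (≤-trans c≤ (≤-reflexive (sym (length-↭range ρ↭))))
...   | j , j≤ , gain≡c = σ , σ↭ , cong₂ _∷_ head≡ tail≡
  where
  u v : List ℕ
  u = take j ρ
  v = drop j ρ
  u++v≡ρ : u ++ v ≡ ρ
  u++v≡ρ = take++drop≡id j ρ
  open InsertMinimum lo u v (subst (All (lo <_)) (sym u++v≡ρ) (range-above ρ↭))
  length-u : length u ≡ j
  length-u = trans (length-take j ρ) (m≤n⇒m⊓n≡m j≤)
  σ↭ : σ ↭ range lo (suc (length cs))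
  σ↭ = ↭-trans (shift lo u v) (prep lo (↭-trans (↭-reflexive u++v≡ρ) ρ↭))
  head≡ : majorCodeAt σ lo ≡ c
  head≡ = trans majorCodeAt-lo (trans (cong₂ majGain u++v≡ρ length-u) gain≡c)
  tail≡ : majorCodeFrom (suc lo) σ (length cs) ≡ cs
  tail≡ = trans (majorCodeFrom-above (length cs))
            (trans (cong (λ t → majorCodeFrom (suc lo) t (length cs)) u++v≡ρ) code≡cs)

length-majorCode : ∀ σ → length (majorCode σ) ≡ length σ
length-majorCode σ = trans (length-map _ (oneTo (length σ))) (length-oneTo (length σ))

module _ {n : ℕ} where

  majorCode≡majorCodeFrom : ∀ {σ} → IsPerm n σ → majorCode σ ≡ majorCodeFrom 1 σ n
  majorCode≡majorCodeFrom {σ} σ-perm =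
    cong (map (majorCodeAt σ)) (trans (cong oneTo (length-IsPerm σ-perm)) (oneTo≡range n))

  maj≡sum-majorCode : ∀ {σ} → IsPerm n σ → maj σ ≡ sum (majorCode σ)
  maj≡sum-majorCode {σ} σ-perm =
    trans (maj≡sum-majorCodeFrom n 1 σ (IsPerm⇒↭range σ-perm)) (cong sum (sym (majorCode≡majorCodeFrom σ-perm)))

  majorCode-isCode : ∀ {σ} → IsPerm n σ → IsCode (majorCode σ)
  majorCode-isCode {σ} σ-perm =
    subst IsCode (sym (majorCode≡majorCodeFrom σ-perm)) (majorCodeFrom-isCode n 1 σ (IsPerm⇒↭range σ-perm))

  majorCode-injective : ∀ {τ τ′} → IsPerm n τ → IsPerm n τ′ → majorCode τ ≡ majorCode τ′ → τ ≡ τ′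
  majorCode-injective {τ} {τ′} τ-perm τ′-perm e =
    majorCodeFrom-injective n 1 τ τ′ (IsPerm⇒↭range τ-perm) (IsPerm⇒↭range τ′-perm)
      (trans (sym (majorCode≡majorCodeFrom τ-perm)) (trans e (majorCode≡majorCodeFrom τ′-perm)))

  majorCode-surjective : ∀ {c} → IsCode c → length c ≡ n → ∃[ τ ] (IsPerm n τ × majorCode τ ≡ c)
  majorCode-surjective {c} c-code refl with majorCodeFrom-surjective c 1 c-code
  ... | τ , τ↭ , code≡c = τ , τ-perm , trans (majorCode≡majorCodeFrom τ-perm) code≡c
    where
    τ-perm : IsPerm n τ
    τ-perm = ↭range⇒IsPerm τ↭

-- Lehmer codes

skip : ℕ → ℕ → ℕ
skip a y = if y <ᵇ a then y else suc y

<ᵇ-skip : ∀ a y z → (skip a z <ᵇ skip a y) ≡ (z <ᵇ y)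
<ᵇ-skip a y z with z <ᵇ a in z<ᵇa | y <ᵇ a in y<ᵇa
... | true | true = refl
... | false | false = refl
... | true | false = trans (<⇒<ᵇ≡true (m≤n⇒m≤1+n z<y)) (sym (<⇒<ᵇ≡true z<y))
  where
  z<y : z < y
  z<y = <-≤-trans (<ᵇ≡true⇒< z a z<ᵇa) (<ᵇ≡false⇒≤ y a y<ᵇa)
... | false | true = trans (≤⇒<ᵇ≡false (m≤n⇒m≤1+n (<⇒≤ y<z))) (sym (≤⇒<ᵇ≡false (<⇒≤ y<z)))
  where
  y<z : y < z
  y<z = <-≤-trans (<ᵇ≡true⇒< y a y<ᵇa) (<ᵇ≡false⇒≤ z a z<ᵇa)

<ᵇ-skip-a : ∀ a z → (skip a z <ᵇ a) ≡ (z <ᵇ a)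
<ᵇ-skip-a a z with z <ᵇ a in z<ᵇa
... | true = z<ᵇa
... | false = ≤⇒<ᵇ≡false (m≤n⇒m≤1+n (<ᵇ≡false⇒≤ z a z<ᵇa))

countLess-skip : ∀ a y zs → countLess (skip a y) (map (skip a) zs) ≡ countLess y zs
countLess-skip a y [] = refl
countLess-skip a y (z ∷ zs)
  rewrite countLess-∷ (skip a y) (skip a z) (map (skip a) zs) | countLess-∷ y z zs | <ᵇ-skip a y z
        | countLess-skip a y zs = refl

countLess-skip-a : ∀ a zs → countLess a (map (skip a) zs) ≡ countLess a zs
countLess-skip-a a [] = refl
countLess-skip-a a (z ∷ zs)
  rewrite countLess-∷ a (skip a z) (map (skip a) zs) | countLess-∷ a z zs | <ᵇ-skip-a a z
        | countLess-skip-a a zs = refl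

lehmer-skip : ∀ a zs → lehmer (map (skip a) zs) ≡ lehmer zs
lehmer-skip a [] = refl
lehmer-skip a (z ∷ zs) = cong₂ _∷_ (countLess-skip a z zs) (lehmer-skip a zs)

countLess-range : ∀ lo k c → c ≤ k → countLess (lo + c) (range lo k) ≡ c
countLess-range lo zero zero _ = refl
countLess-range lo (suc k) zero _
  rewrite +-identityʳ lo | countLess-∷ lo lo (range (suc lo) k) | ≤⇒<ᵇ≡false (≤-refl {lo}) =
  countLess-all≥ lo (All.map <⇒≤ (range-≥ (suc lo) k))
countLess-range lo (suc k) (suc c) (s≤s c≤k)
  rewrite countLess-∷ (lo + suc c) lo (range (suc lo) k) | <⇒<ᵇ≡true (m<m+n lo (s≤s (z≤n {c}))) | +-suc lo c =
  cong suc (countLess-range (suc lo) k c c≤k)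

map-skip-range : ∀ a lo k → a ≤ lo → map (skip a) (range lo k) ≡ range (suc lo) k
map-skip-range a lo zero _ = refl
map-skip-range a lo (suc k) a≤lo rewrite ≤⇒<ᵇ≡false a≤lo =
  cong (suc lo ∷_) (map-skip-range a (suc lo) k (m≤n⇒m≤1+n a≤lo))

range-insert : ∀ lo k a → lo ≤ a → a ≤ lo + k → a ∷ map (skip a) (range lo k) ↭ range lo (suc k)
range-insert lo zero a lo≤a a≤lo+0
  rewrite ≤-antisym (≤-trans a≤lo+0 (≤-reflexive (+-identityʳ lo))) lo≤a = ↭-refl
range-insert lo (suc k) a lo≤a a≤ with lo ≟ a
... | yes refl = ↭-reflexive (cong (lo ∷_) (map-skip-range lo lo (suc k) ≤-refl))
... | no lo≢a rewrite <⇒<ᵇ≡true (≤∧≢⇒< lo≤a lo≢a) =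
  ↭-trans (swap a lo ↭-refl)
    (prep lo (range-insert (suc lo) k a (≤∧≢⇒< lo≤a lo≢a) (≤-trans a≤ (≤-reflexive (+-suc lo k)))))

lehmer-surjective : ∀ {n c} → IsCode c → length c ≡ n → ∃[ τ ] (IsPerm n τ × lehmer τ ≡ c)
lehmer-surjective [] refl = [] , ↭-refl , refl
lehmer-surjective {c = c ∷ cs} (c≤ ∷ cs-code) refl with lehmer-surjective cs-code refl
... | τ , τ-perm , lehmerτ≡cs =
  suc c ∷ map (skip (suc c)) τ ,
  ↭range⇒IsPerm (↭-trans (prep (suc c) (map⁺ (skip (suc c)) τ↭))
                         (range-insert 1 (length cs) (suc c) (s≤s z≤n) (s≤s c≤))) ,
  cong₂ _∷_ (trans (countLess-skip-a (suc c) τ) (trans (countLess-↭ (suc c) τ↭) (countLess-range 1 (length cs) c c≤)))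
            (trans (lehmer-skip (suc c) τ) lehmerτ≡cs)
  where
  τ↭ : τ ↭ range 1 (length cs)
  τ↭ = IsPerm⇒↭range τ-perm

length-lehmer : ∀ σ → length (lehmer σ) ≡ length σ
length-lehmer [] = refl
length-lehmer (x ∷ σ) = cong suc (length-lehmer σ)

lehmer-isCode : ∀ σ → IsCode (lehmer σ)
lehmer-isCode [] = []
lehmer-isCode (x ∷ σ) =
  ≤-trans (length-filter (_<? x) σ) (≤-reflexive (sym (length-lehmer σ))) ∷ lehmer-isCode σ

sum-lehmer : ∀ σ → sum (lehmer σ) ≡ inv σ
sum-lehmer [] = refl
sum-lehmer (x ∷ σ) = cong (_+_ (countLess x σ)) (sum-lehmer σ)

-- The four bijections

module _ {n : ℕ} where

  𝓕-IsPerm : ∀ {σ} → IsPerm n σ → IsPerm n (𝓕 σ)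
  𝓕-IsPerm {σ} σ-perm = ↭-trans (𝓕-↭ σ) σ-perm

  𝓕∘𝓕⁻¹ : ∀ {σ} → IsPerm n σ → IsPerm n (𝓕⁻¹ σ) × 𝓕 (𝓕⁻¹ σ) ≡ σ
  𝓕∘𝓕⁻¹ {σ} σ-perm with 𝓕-surjective (IsPerm⇒Unique σ-perm)
  ... | τ , τ↭σ , 𝓕τ≡σ = theUnique-finds 𝓕 σ σ-perm (τ , ↭-trans τ↭σ σ-perm , 𝓕τ≡σ)

  inv≡maj∘𝓕⁻¹ : ∀ {σ} → IsPerm n σ → inv σ ≡ maj (𝓕⁻¹ σ)
  inv≡maj∘𝓕⁻¹ σ-perm with 𝓕∘𝓕⁻¹ σ-perm
  ... | ρ-perm , 𝓕ρ≡σ = sym (trans (maj≡inv∘𝓕 (IsPerm⇒Unique ρ-perm)) (cong inv 𝓕ρ≡σ))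

  𝓜-spec : ∀ {σ} → IsPerm n σ → IsPerm n (𝓜 σ) × majorCode (𝓜 σ) ≡ lehmer σ
  𝓜-spec {σ} σ-perm = theUnique-finds majorCode (lehmer σ) σ-perm
    (majorCode-surjective (lehmer-isCode σ) (trans (length-lehmer σ) (length-IsPerm σ-perm)))

  inv≡maj∘𝓜 : ∀ {σ} → IsPerm n σ → inv σ ≡ maj (𝓜 σ)
  inv≡maj∘𝓜 {σ} σ-perm with 𝓜-spec σ-perm
  ... | ρ-perm , code≡lehmer = begin
    inv σ                  ≡⟨ sum-lehmer σ ⟨
    sum (lehmer σ)         ≡⟨ cong sum code≡lehmer ⟨
    sum (majorCode (𝓜 σ))  ≡⟨ maj≡sum-majorCode ρ-perm ⟨
    maj (𝓜 σ)              ∎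
    where open ≡-Reasoning

  𝓜-surjective : ∀ {σ} → IsPerm n σ → ∃[ τ ] (IsPerm n τ × 𝓜 τ ≡ σ)
  𝓜-surjective {σ} σ-perm
    with lehmer-surjective (majorCode-isCode σ-perm) (trans (length-majorCode σ) (length-IsPerm σ-perm))
  ... | τ , τ-perm , lehmer≡code with 𝓜-spec τ-perm
  ...   | ρ-perm , code≡lehmer =
    τ , τ-perm , majorCode-injective ρ-perm σ-perm (trans code≡lehmer lehmer≡code)

  𝓜∘𝓜⁻¹ : ∀ {σ} → IsPerm n σ → IsPerm n (𝓜⁻¹ σ) × 𝓜 (𝓜⁻¹ σ) ≡ σ
  𝓜∘𝓜⁻¹ {σ} σ-perm = theUnique-finds 𝓜 σ σ-perm (𝓜-surjective σ-perm)

  maj≡inv∘𝓜⁻¹ : ∀ {σ} → IsPerm n σ → maj σ ≡ inv (𝓜⁻¹ σ)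
  maj≡inv∘𝓜⁻¹ σ-perm with 𝓜∘𝓜⁻¹ σ-perm
  ... | ρ-perm , 𝓜ρ≡σ = sym (trans (inv≡maj∘𝓜 ρ-perm) (cong maj 𝓜ρ≡σ))

theorem6p9 : (n : ℕ) → 0 < n →
    Mesic n 𝓜 majMinusInv (+ 0) × Mesic n 𝓜⁻¹ majMinusInv (+ 0) ×
    Mesic n 𝓕 majMinusInv (+ 0) × Mesic n 𝓕⁻¹ majMinusInv (+ 0)
theorem6p9 n _ =
    inv≡maj∘X⇒mesic n 𝓜 (λ p → proj₁ (𝓜-spec p)) inv≡maj∘𝓜
  , maj≡inv∘X⇒mesic n 𝓜⁻¹ (λ p → proj₁ (𝓜∘𝓜⁻¹ p)) maj≡inv∘𝓜⁻¹
  , maj≡inv∘X⇒mesic n 𝓕 𝓕-IsPerm (λ p → maj≡inv∘𝓕 (IsPerm⇒Unique p))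
  , inv≡maj∘X⇒mesic n 𝓕⁻¹ (λ p → proj₁ (𝓕∘𝓕⁻¹ p)) inv≡maj∘𝓕⁻¹
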